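{- Let $A\geq a\geq 1$ be integers, and let $Omes_{1,A,a}$ be the set of overpartitions $\pi$ such that all parts of $\pi$ of size $\equiv a\pmod A$ and less than $mes_{1,A,a}(\pi)$ are overlined. Then \[ \sum_{\pi\in Omes_{1,A,a}}z^{mes_{1,A,a}(\pi)}q^{|\pi|} =\frac{(-q;q)_{\infty}}{(q;q)_{\infty}}\sum_{k=0}^{\infty}z^{kA+a}\bigg[q^{A\binom{k}{2}+ka} \frac{(q^a;q^A)_k}{(-q^a;q^A)_k}-2q^{A\binom{k+1}{2}+(k+1)a} \frac{(q^a;q^A)_k}{(-q^a;q^A)_{k+1}}\bigg]. \]
   Context: An overpartition is a partition (finite non-increasing sequence of positive integers) in which the first occurrence of each part value may be overlined; $|\pi|$ is the sum of parts. A part is of size $t$ if it equals $t$ or $\overline{t}$. $(a;q)_\infty=\prod_{i\geq0}(1-aq^i)$, $(a;q)_n=(a;q)_\infty/(aq^n;q)_\infty$; $|q|<1$, $z$ a formal variable. $mes_{1,A,a}(\pi)$ is the smallest positive integer $\equiv a\pmod A$ such that no part of $\pi$ has that size. -}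

module Defs where

open import Data.Nat as ℕ using (ℕ; zero; suc; _≤_; _<_; _>_; _≤?_; ∣_-_∣)
open import Data.Nat.Divisibility using (_∣_)
open import Data.Nat.Combinatorics using (_C_)
open import Data.Integer as ℤ using (ℤ; +_; -[1+_])
open import Data.Bool using (Bool; true; false)
open import Data.Product using (_×_; _,_; ∃-syntax)
open import Data.Sum using (_⊎_)
open import Data.List using (List; []; _∷_; map)
open import Data.Nat.ListAction using (sum)
open import Data.List.Membership.Propositional using (_∈_)
open import Data.List.Relation.Unary.All using (All)
open import Data.List.Relation.Unary.Linked using (Linked)
open import Relation.Binary.PropositionalEquality using (_≡_)
open import Relation.Nullary using (¬_; yes; no)

-- A part is a pair (size , overlined?).
Part : Set
Part = ℕ × Bool

size : Part → ℕ
size (t , _) = t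

-- Ordering of consecutive parts in the canonical listing of an
-- overpartition: sizes are non-increasing, and among equal sizes only the
-- first occurrence may be overlined (so a later equal part is never
-- overlined).
NextPart : Part → Part → Set
NextPart (s , _) (t , b) = (s > t) ⊎ ((s ≡ t) × (b ≡ false))

IsOverpartition : List Part → Set
IsOverpartition π = All (λ p → 1 ≤ size p) π × Linked NextPart π

weight : List Part → ℕ
weight π = sum (map size π)

HasSize : List Part → ℕ → Set
HasSize π t = ∃[ b ] ((t , b) ∈ π)

_≡_[mod_] : ℕ → ℕ → ℕ → Set
x ≡ y [mod A ] = A ∣ ∣ x - y ∣

IsMes : ℕ → ℕ → List Part → ℕ → Set
IsMes A a π x =
  (1 ≤ x) × (x ≡ a [mod A ]) × ¬ HasSize π x ×
  (∀ y → 1 ≤ y → y < x → y ≡ a [mod A ] → HasSize π y)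

InOmes : ℕ → ℕ → List Part → Set
InOmes A a π =
  ∀ x → IsMes A a π x →
  ∀ t b → (t , b) ∈ π → t ≡ a [mod A ] → t < x → b ≡ true

PS : Set
PS = ℕ → ℤ

sumTo : ℕ → (ℕ → ℤ) → ℤ
sumTo zero    f = + 0
sumTo (suc n) f = sumTo n f ℤ.+ f n

ifEq : ℕ → ℕ → ℤ → ℤ
ifEq n m c with n ℕ.≟ m
... | yes _ = c
... | no  _ = + 0

one : PS
one n = ifEq n 0 (+ 1)

_⊕_ : PS → PS → PS
(f ⊕ g) n = f n ℤ.+ g n

_⊖_ : PS → PS → PS
(f ⊖ g) n = f n ℤ.- g n

_⊛_ : PS → PS → PS
(f ⊛ g) n = sumTo (suc n) (λ i → f i ℤ.* g (n ℕ.∸ i))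

infixl 7 _⊛_
infixl 6 _⊕_ _⊖_

scale : ℤ → PS → PS
scale c f n = c ℤ.* f n

shift : ℕ → PS → PS
shift e f n with e ≤? n
... | yes _ = f (n ℕ.∸ e)
... | no  _ = + 0

onePlus : ℤ → ℕ → PS
onePlus c d n = ifEq n 0 (+ 1) ℤ.+ ifEq n d c

-- the series 1/(1 - c q^d) = Σ_j c^j q^{jd}   (used only with d ≥ 1)
geom : ℤ → ℕ → PS
geom c d n = sumTo (suc n) (λ j → ifEq (j ℕ.* d) n (c ℤ.^ j))

prodTo : ℕ → (ℕ → PS) → PS
prodTo zero    F = one
prodTo (suc k) F = prodTo k F ⊛ F k

-- ∏_{i ≥ 1} F i, for factors F i ≡ 1 (mod q^i): the coefficient of q^n
-- only depends on the factors with i ≤ n.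
prodInf : (ℕ → PS) → PS
prodInf F n = prodTo n (λ i → F (suc i)) n

minusQQ∞ : PS
minusQQ∞ = prodInf (λ i → onePlus (+ 1) i)

invQQ∞ : PS
invQQ∞ = prodInf (λ i → geom (+ 1) i)

qPoch : ℕ → ℕ → ℕ → PS
qPoch a A k = prodTo k (λ i → onePlus (-[1+ 0 ]) (a ℕ.+ i ℕ.* A))

invNegPoch : ℕ → ℕ → ℕ → PS
invNegPoch a A k = prodTo k (λ i → geom (-[1+ 0 ]) (a ℕ.+ i ℕ.* A))

bracket : ℕ → ℕ → ℕ → PS
bracket A a k =
  shift (A ℕ.* (k C 2) ℕ.+ k ℕ.* a) (qPoch a A k ⊛ invNegPoch a A k)
  ⊖ scale (+ 2) (shift (A ℕ.* (suc k C 2) ℕ.+ suc k ℕ.* a)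
                       (qPoch a A k ⊛ invNegPoch a A (suc k)))

-- coefficient of z^m q^n in the right-hand side
--   (-q;q)_∞/(q;q)_∞ Σ_{k ≥ 0} z^{kA+a} bracket_k.
-- Since A ≥ 1, only k ≤ m can satisfy kA + a = m.
rhsCoeff : ℕ → ℕ → ℕ → ℕ → ℤ
rhsCoeff A a m n =
  sumTo (suc m) (λ k → ifEq (k ℕ.* A ℕ.+ a) m
                          ((minusQQ∞ ⊛ invQQ∞ ⊛ bracket A a k) n))

-- Write ap j = a + jA. If mes(π) = ap k, then π lies in Omes exactly when it has no
-- part of size ap k and, for every j < k, a single part of size ap j, which is
-- overlined; all other sizes are unrestricted. So the generating function of these π
-- is the product over all sizes t of (1 + q^t)/(1 - q^t), with the factor at ap j
-- (j < k) replaced by q^(ap j) and the one at ap k by 1, that is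
--   q^(ap 0 + ... + ap (k-1)) (-q;q)_∞/(q;q)_∞ ∏_{j ≤ k} (1 - q^(ap j))/(1 + q^(ap j)).
-- The k-th bracket equals the same quotient, because
--   1/(-q^a;q^A)_k - 2 q^(ap k)/(-q^a;q^A)_(k+1) = (1 - q^(ap k))/(-q^a;q^A)_(k+1).
-- The coefficient of q^n is realised by listing the overpartitions with parts ≤ n + ap k
-- size by size, each size contributing the list counted by its factor. If m is not of
-- the form ap k, both sides vanish.

module Submission where

open import Defs
open import Data.Bool using (Bool; true; false; if_then_else_; _∨_; T)
open import Data.Empty using (⊥; ⊥-elim)
open import Data.Integer as ℤ using (ℤ; +_; -[1+_])
import Data.Integer.Properties as ℤP
open import Data.Integer.Tactic.RingSolver using (solve-∀)
open import Data.List using (List; []; _∷_; _++_; map; concatMap; length; replicate)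
import Data.List.Properties as ListP
open import Data.List.Membership.Propositional using (_∈_; find; lose)
open import Data.List.Membership.Propositional.Properties using (∈-map⁺; ∈-map⁻; ∈-++⁺ˡ; ∈-++⁺ʳ; ∈-++⁻; ∈-concatMap⁺; ∈-concatMap⁻)
open import Data.List.Relation.Unary.All as All using (All; []; _∷_; lookup)
import Data.List.Relation.Unary.All.Properties as AllP
open import Data.List.Relation.Unary.AllPairs using ([]; _∷_)
open import Data.List.Relation.Unary.Any using (here; there)
open import Data.List.Relation.Unary.Linked as Linked using (Linked; []; [-]; _∷_)
open import Data.List.Relation.Unary.Unique.Propositional using (Unique)
import Data.List.Relation.Unary.Unique.Propositional.Properties as UniqueP
open import Data.Nat as ℕ using (ℕ; zero; suc; _≤_; _<_; _>_; z≤n; s≤s; _∸_)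
import Data.Nat.Properties as ℕP
open import Data.Nat.Combinatorics using (_C_; nCk+nC[k+1]≡[n+1]C[k+1]; nC1≡n)
open import Data.Nat.Divisibility using (divides; ∣⇒≤; _∣?_)
open import Data.Nat.ListAction.Properties using (sum-++)
import Data.Nat.Tactic.RingSolver as ℕSolver
open import Data.Product using (_×_; _,_; ∃-syntax; proj₁; proj₂)
open import Data.Sum using (_⊎_; inj₁; inj₂)
open import Data.Unit using (⊤; tt)
open import Function.Bundles using (_⇔_; mk⇔)
open import Relation.Binary.Bundles using (Setoid)
open import Relation.Binary.Definitions using (tri<; tri≈; tri>)
open import Relation.Binary.PropositionalEquality
import Relation.Binary.Reasoning.Setoid as SetoidReasoning
open import Relation.Nullary using (¬_; yes; no; Dec)
open import Relation.Nullary.Decidable using (dec-true; dec-false)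

ifEq-≡ : ∀ {n m} c → n ≡ m → ifEq n m c ≡ c
ifEq-≡ {n} {m} c eq with n ℕ.≟ m
... | yes _ = refl
... | no n≢m = ⊥-elim (n≢m eq)

ifEq-≢ : ∀ {n m} c → ¬ n ≡ m → ifEq n m c ≡ + 0
ifEq-≢ {n} {m} c n≢m with n ℕ.≟ m
... | yes eq = ⊥-elim (n≢m eq)
... | no _ = refl

*-ifEq : ∀ x y c v → c ℤ.* ifEq x y v ≡ ifEq x y (c ℤ.* v)
*-ifEq x y c v with x ℕ.≟ y
... | yes _ = refl
... | no _ = ℤP.*-zeroʳ c

ifEq-cong-⇔ : ∀ {x y x' y'} v → (x ≡ y → x' ≡ y') → (x' ≡ y' → x ≡ y) → ifEq x y v ≡ ifEq x' y' v
ifEq-cong-⇔ {x} {y} v to from with x ℕ.≟ y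
... | yes eq = sym (ifEq-≡ v (to eq))
... | no x≢y = sym (ifEq-≢ v (λ eq → x≢y (from eq)))

sumTo-cong : ∀ n {f g : ℕ → ℤ} → (∀ i → i < n → f i ≡ g i) → sumTo n f ≡ sumTo n g
sumTo-cong zero h = refl
sumTo-cong (suc n) h = cong₂ ℤ._+_ (sumTo-cong n (λ i i<n → h i (ℕP.m≤n⇒m≤1+n i<n))) (h n ℕP.≤-refl)

sumTo-zero : ∀ n {f : ℕ → ℤ} → (∀ i → i < n → f i ≡ + 0) → sumTo n f ≡ + 0
sumTo-zero zero h = refl
sumTo-zero (suc n) {f} h
  rewrite sumTo-zero n {f} (λ i i<n → h i (ℕP.m≤n⇒m≤1+n i<n)) | h n ℕP.≤-refl = refl

sumTo-distrib-+ : ∀ n (f g : ℕ → ℤ) → sumTo n (λ i → f i ℤ.+ g i) ≡ sumTo n f ℤ.+ sumTo n g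
sumTo-distrib-+ zero f g = refl
sumTo-distrib-+ (suc n) f g rewrite sumTo-distrib-+ n f g = interchange (sumTo n f) (sumTo n g) (f n) (g n)
  where
  interchange : ∀ a b c d → (a ℤ.+ b) ℤ.+ (c ℤ.+ d) ≡ (a ℤ.+ c) ℤ.+ (b ℤ.+ d)
  interchange = solve-∀

*-distribˡ-sumTo : ∀ n c (f : ℕ → ℤ) → c ℤ.* sumTo n f ≡ sumTo n (λ i → c ℤ.* f i)
*-distribˡ-sumTo zero c f = ℤP.*-zeroʳ c
*-distribˡ-sumTo (suc n) c f rewrite sym (*-distribˡ-sumTo n c f) = ℤP.*-distribˡ-+ c (sumTo n f) (f n)

*-distribʳ-sumTo : ∀ n c (f : ℕ → ℤ) → sumTo n f ℤ.* c ≡ sumTo n (λ i → f i ℤ.* c)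
*-distribʳ-sumTo n c f = trans (ℤP.*-comm (sumTo n f) c)
  (trans (*-distribˡ-sumTo n c f) (sumTo-cong n (λ i _ → ℤP.*-comm c (f i))))

neg-distrib-sumTo : ∀ n (f : ℕ → ℤ) → ℤ.- sumTo n f ≡ sumTo n (λ i → ℤ.- f i)
neg-distrib-sumTo zero f = refl
neg-distrib-sumTo (suc n) f rewrite sym (neg-distrib-sumTo n f) = ℤP.neg-distrib-+ (sumTo n f) (f n)

sumTo-suc : ∀ n (f : ℕ → ℤ) → sumTo (suc n) f ≡ f 0 ℤ.+ sumTo n (λ i → f (suc i))
sumTo-suc zero f = trans (ℤP.+-identityˡ (f 0)) (sym (ℤP.+-identityʳ (f 0)))
sumTo-suc (suc n) f rewrite sumTo-suc n f = ℤP.+-assoc (f 0) _ _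

sumTo-+ : ∀ m r (f : ℕ → ℤ) → sumTo (m ℕ.+ r) f ≡ sumTo m f ℤ.+ sumTo r (λ i → f (m ℕ.+ i))
sumTo-+ m zero f rewrite ℕP.+-identityʳ m = sym (ℤP.+-identityʳ _)
sumTo-+ m (suc r) f rewrite ℕP.+-suc m r | sumTo-+ m r f = ℤP.+-assoc (sumTo m f) _ _

sumTo-reverse : ∀ n (f : ℕ → ℤ) → sumTo (suc n) f ≡ sumTo (suc n) (λ i → f (n ∸ i))
sumTo-reverse zero f = refl
sumTo-reverse (suc n) f = begin
    sumTo (suc n) f ℤ.+ f (suc n)                     ≡⟨ cong (ℤ._+ f (suc n)) (sumTo-reverse n f) ⟩
    sumTo (suc n) (λ i → f (n ∸ i)) ℤ.+ f (suc n)     ≡⟨ ℤP.+-comm _ (f (suc n)) ⟩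
    f (suc n) ℤ.+ sumTo (suc n) (λ i → f (n ∸ i))     ≡⟨ sym (sumTo-suc (suc n) (λ i → f (suc n ∸ i))) ⟩
    sumTo (suc (suc n)) (λ i → f (suc n ∸ i))         ∎
  where open ≡-Reasoning

sumTo-single : ∀ n e (f : ℕ → ℤ) → e < n → (∀ i → i < n → ¬ i ≡ e → f i ≡ + 0) → sumTo n f ≡ f e
sumTo-single (suc n) e f e<1+n h with e ℕ.≟ n
... | yes refl
  rewrite sumTo-zero n {f} (λ i i<n → h i (ℕP.m≤n⇒m≤1+n i<n) (ℕP.<⇒≢ i<n)) = ℤP.+-identityˡ (f e)
... | no e≢n rewrite h n ℕP.≤-refl (λ eq → e≢n (sym eq)) | ℤP.+-identityʳ (sumTo n f) =
  sumTo-single n e f (ℕP.≤∧≢⇒< (ℕP.≤-pred e<1+n) e≢n) (λ i i<n → h i (ℕP.m≤n⇒m≤1+n i<n))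

sumTo-extend : ∀ m n (f : ℕ → ℤ) → m ≤ n → (∀ i → m ≤ i → i < n → f i ≡ + 0) → sumTo n f ≡ sumTo m f
sumTo-extend m n f m≤n h = begin
    sumTo n f                                          ≡⟨ cong (λ k → sumTo k f) (sym (ℕP.m+[n∸m]≡n m≤n)) ⟩
    sumTo (m ℕ.+ (n ∸ m)) f                            ≡⟨ sumTo-+ m (n ∸ m) f ⟩
    sumTo m f ℤ.+ sumTo (n ∸ m) (λ i → f (m ℕ.+ i))    ≡⟨ cong (λ z → sumTo m f ℤ.+ z) (sumTo-zero (n ∸ m) tail-zero) ⟩
    sumTo m f ℤ.+ + 0                                  ≡⟨ ℤP.+-identityʳ _ ⟩
    sumTo m f                                          ∎
  where
  open ≡-Reasoning
  tail-zero : ∀ i → i < n ∸ m → f (m ℕ.+ i) ≡ + 0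
  tail-zero i i< = h (m ℕ.+ i) (ℕP.m≤m+n m i)
    (subst (m ℕ.+ i <_) (ℕP.m+[n∸m]≡n m≤n) (ℕP.+-monoʳ-< m i<))

sumTo-triangle : ∀ n (F : ℕ → ℕ → ℤ) →
  sumTo (suc n) (λ i → sumTo (suc i) (λ j → F i j)) ≡
  sumTo (suc n) (λ j → sumTo (suc (n ∸ j)) (λ d → F (j ℕ.+ d) j))
sumTo-triangle zero F = refl
sumTo-triangle (suc n) F = begin
    sumTo (suc n) (λ i → sumTo (suc i) (F i)) ℤ.+ sumTo (suc (suc n)) (F (suc n))
  ≡⟨ cong (ℤ._+ sumTo (suc (suc n)) (F (suc n))) (sumTo-triangle n F) ⟩
    sumTo (suc n) column ℤ.+ (sumTo (suc n) (F (suc n)) ℤ.+ F (suc n) (suc n))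
  ≡⟨ sym (ℤP.+-assoc (sumTo (suc n) column) _ _) ⟩
    (sumTo (suc n) column ℤ.+ sumTo (suc n) (F (suc n))) ℤ.+ F (suc n) (suc n)
  ≡⟨ cong₂ ℤ._+_ (sym (sumTo-distrib-+ (suc n) column (F (suc n)))) corner ⟩
    sumTo (suc n) (λ j → column j ℤ.+ F (suc n) j) ℤ.+ column′ (suc n)
  ≡⟨ cong (ℤ._+ column′ (suc n)) (sumTo-cong (suc n) extend-column) ⟩
    sumTo (suc n) column′ ℤ.+ column′ (suc n)
  ∎
  where
  open ≡-Reasoning
  column column′ : ℕ → ℤ
  column j = sumTo (suc (n ∸ j)) (λ d → F (j ℕ.+ d) j)
  column′ j = sumTo (suc (suc n ∸ j)) (λ d → F (j ℕ.+ d) j)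
  corner : F (suc n) (suc n) ≡ column′ (suc n)
  corner rewrite ℕP.n∸n≡0 n | ℕP.+-identityʳ n = sym (ℤP.+-identityˡ _)
  extend-column : ∀ j → j < suc n → column j ℤ.+ F (suc n) j ≡ column′ j
  extend-column j j<1+n rewrite ℕP.+-∸-assoc 1 (ℕP.≤-pred j<1+n)
    | ℕP.+-suc j (n ∸ j) | ℕP.m+[n∸m]≡n (ℕP.≤-pred j<1+n) = refl

-- Power series

infix 4 _≈_
_≈_ : PS → PS → Set
f ≈ g = ∀ n → f n ≡ g n

≈-refl : ∀ {f} → f ≈ f
≈-refl n = refl

≈-sym : ∀ {f g} → f ≈ g → g ≈ f
≈-sym p n = sym (p n)

≈-trans : ∀ {f g h} → f ≈ g → g ≈ h → f ≈ h
≈-trans p q n = trans (p n) (q n)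

PS-setoid : Setoid _ _
PS-setoid = record
  { Carrier = PS ; _≈_ = _≈_
  ; isEquivalence = record
    { refl = λ {f} → ≈-refl {f} ; sym = λ {f} {g} → ≈-sym {f} {g} ; trans = λ {f} {g} {h} → ≈-trans {f} {g} {h} } }

module ≈-Reasoning = SetoidReasoning PS-setoid

⊕-cong : ∀ {f f' g g'} → f ≈ f' → g ≈ g' → f ⊕ g ≈ f' ⊕ g'
⊕-cong p q n = cong₂ ℤ._+_ (p n) (q n)

⊖-cong : ∀ {f f' g g'} → f ≈ f' → g ≈ g' → f ⊖ g ≈ f' ⊖ g'
⊖-cong p q n = cong₂ ℤ._-_ (p n) (q n)

scale-cong : ∀ c {f g} → f ≈ g → scale c f ≈ scale c g
scale-cong c p n = cong (c ℤ.*_) (p n)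

⊛-cong-upTo : ∀ n {f f' g g'} → (∀ i → i ≤ n → f i ≡ f' i) → (∀ i → i ≤ n → g i ≡ g' i) →
  (f ⊛ g) n ≡ (f' ⊛ g') n
⊛-cong-upTo n hf hg = sumTo-cong (suc n) λ i i<1+n →
  cong₂ ℤ._*_ (hf i (ℕP.≤-pred i<1+n)) (hg (n ∸ i) (ℕP.m∸n≤m n i))

⊛-cong : ∀ {f f' g g'} → f ≈ f' → g ≈ g' → f ⊛ g ≈ f' ⊛ g'
⊛-cong p q n = ⊛-cong-upTo n (λ i _ → p i) (λ i _ → q i)

⊛-congˡ : ∀ {f f'} g → f ≈ f' → f ⊛ g ≈ f' ⊛ g
⊛-congˡ g p = ⊛-cong p (≈-refl {g})

⊛-congʳ : ∀ f {g g'} → g ≈ g' → f ⊛ g ≈ f ⊛ g'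
⊛-congʳ f p = ⊛-cong (≈-refl {f}) p

⊛-comm : ∀ f g → f ⊛ g ≈ g ⊛ f
⊛-comm f g n = trans (sumTo-reverse n _) (sumTo-cong (suc n) λ i i<1+n →
  trans (cong (λ k → f (n ∸ i) ℤ.* g k) (ℕP.m∸[m∸n]≡n (ℕP.≤-pred i<1+n))) (ℤP.*-comm (f (n ∸ i)) (g i)))

⊛-identityʳ : ∀ f → f ⊛ one ≈ f
⊛-identityʳ f n = trans (sumTo-single (suc n) n _ ℕP.≤-refl off-diagonal)
  (trans (cong (λ k → f n ℤ.* one k) (ℕP.n∸n≡0 n)) (ℤP.*-identityʳ (f n)))
  where
  off-diagonal : ∀ i → i < suc n → ¬ i ≡ n → f i ℤ.* one (n ∸ i) ≡ + 0
  off-diagonal i i<1+n i≢n = trans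
    (cong (f i ℤ.*_) (ifEq-≢ (+ 1) λ eq → i≢n (ℕP.≤-antisym (ℕP.≤-pred i<1+n) (ℕP.m∸n≡0⇒m≤n eq))))
    (ℤP.*-zeroʳ (f i))

⊛-identityˡ : ∀ f → one ⊛ f ≈ f
⊛-identityˡ f = ≈-trans (⊛-comm one f) (⊛-identityʳ f)

⊛-assoc : ∀ f g h → (f ⊛ g) ⊛ h ≈ f ⊛ (g ⊛ h)
⊛-assoc f g h n = begin
    sumTo (suc n) (λ i → sumTo (suc i) (λ j → f j ℤ.* g (i ∸ j)) ℤ.* h (n ∸ i))
  ≡⟨ sumTo-cong (suc n) (λ i _ → *-distribʳ-sumTo (suc i) (h (n ∸ i)) _) ⟩
    sumTo (suc n) (λ i → sumTo (suc i) (λ j → f j ℤ.* g (i ∸ j) ℤ.* h (n ∸ i)))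
  ≡⟨ sumTo-triangle n (λ i j → f j ℤ.* g (i ∸ j) ℤ.* h (n ∸ i)) ⟩
    sumTo (suc n) (λ j → sumTo (suc (n ∸ j)) (λ d → f j ℤ.* g (j ℕ.+ d ∸ j) ℤ.* h (n ∸ (j ℕ.+ d))))
  ≡⟨ sumTo-cong (suc n) (λ j _ → sumTo-cong (suc (n ∸ j)) (λ d _ → reindex j d)) ⟩
    sumTo (suc n) (λ j → sumTo (suc (n ∸ j)) (λ d → f j ℤ.* (g d ℤ.* h (n ∸ j ∸ d))))
  ≡⟨ sumTo-cong (suc n) (λ j _ → sym (*-distribˡ-sumTo (suc (n ∸ j)) (f j) _)) ⟩
    sumTo (suc n) (λ j → f j ℤ.* sumTo (suc (n ∸ j)) (λ d → g d ℤ.* h (n ∸ j ∸ d)))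
  ∎
  where
  open ≡-Reasoning
  reindex : ∀ j d → f j ℤ.* g (j ℕ.+ d ∸ j) ℤ.* h (n ∸ (j ℕ.+ d)) ≡ f j ℤ.* (g d ℤ.* h (n ∸ j ∸ d))
  reindex j d rewrite ℕP.m+n∸m≡n j d | sym (ℕP.∸-+-assoc n j d) = ℤP.*-assoc (f j) (g d) _

⊛-distribˡ-⊕ : ∀ f g h → f ⊛ (g ⊕ h) ≈ (f ⊛ g) ⊕ (f ⊛ h)
⊛-distribˡ-⊕ f g h n =
  trans (sumTo-cong (suc n) (λ i _ → ℤP.*-distribˡ-+ (f i) _ _)) (sumTo-distrib-+ (suc n) _ _)

⊛-distribˡ-⊖ : ∀ f g h → f ⊛ (g ⊖ h) ≈ (f ⊛ g) ⊖ (f ⊛ h)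
⊛-distribˡ-⊖ f g h n = trans (sumTo-cong (suc n) (λ i _ → expand (f i) (g (n ∸ i)) (h (n ∸ i))))
  (trans (sumTo-distrib-+ (suc n) _ _) (cong (λ z → (f ⊛ g) n ℤ.+ z) (sym (neg-distrib-sumTo (suc n) _))))
  where
  expand : ∀ x y z → x ℤ.* (y ℤ.- z) ≡ x ℤ.* y ℤ.+ ℤ.- (x ℤ.* z)
  expand = solve-∀

⊛-distribʳ-⊖ : ∀ f g h → (f ⊖ g) ⊛ h ≈ (f ⊛ h) ⊖ (g ⊛ h)
⊛-distribʳ-⊖ f g h = ≈-trans (⊛-comm (f ⊖ g) h)
  (≈-trans (⊛-distribˡ-⊖ h f g) (⊖-cong (⊛-comm h f) (⊛-comm h g)))

⊛-scaleʳ : ∀ c f g → f ⊛ scale c g ≈ scale c (f ⊛ g)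
⊛-scaleʳ c f g n = trans (sumTo-cong (suc n) (λ i _ → swap c (f i) (g (n ∸ i))))
  (sym (*-distribˡ-sumTo (suc n) c _))
  where
  swap : ∀ c x y → x ℤ.* (c ℤ.* y) ≡ c ℤ.* (x ℤ.* y)
  swap = solve-∀

⊛-scaleˡ : ∀ c f g → scale c f ⊛ g ≈ scale c (f ⊛ g)
⊛-scaleˡ c f g = ≈-trans (⊛-comm (scale c f) g) (≈-trans (⊛-scaleʳ c g f) (scale-cong c (⊛-comm g f)))

⊛-interchange : ∀ f g h k → (f ⊛ g) ⊛ (h ⊛ k) ≈ (f ⊛ h) ⊛ (g ⊛ k)
⊛-interchange f g h k = begin
    (f ⊛ g) ⊛ (h ⊛ k)   ≈⟨ ⊛-assoc f g (h ⊛ k) ⟩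
    f ⊛ (g ⊛ (h ⊛ k))   ≈⟨ ⊛-congʳ f (≈-sym (⊛-assoc g h k)) ⟩
    f ⊛ ((g ⊛ h) ⊛ k)   ≈⟨ ⊛-congʳ f (⊛-congˡ k (⊛-comm g h)) ⟩
    f ⊛ ((h ⊛ g) ⊛ k)   ≈⟨ ⊛-congʳ f (⊛-assoc h g k) ⟩
    f ⊛ (h ⊛ (g ⊛ k))   ≈⟨ ≈-sym (⊛-assoc f h (g ⊛ k)) ⟩
    (f ⊛ h) ⊛ (g ⊛ k)   ∎
  where open ≈-Reasoning

⊛-swapʳ : ∀ f g h → (f ⊛ g) ⊛ h ≈ (f ⊛ h) ⊛ g
⊛-swapʳ f g h = ≈-trans (⊛-assoc f g h) (≈-trans (⊛-congʳ f (⊛-comm g h)) (≈-sym (⊛-assoc f h g)))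

⊛-rotate : ∀ f g h → f ⊛ (g ⊛ h) ≈ g ⊛ (f ⊛ h)
⊛-rotate f g h = ≈-trans (≈-sym (⊛-assoc f g h)) (≈-trans (⊛-congˡ h (⊛-comm f g)) (⊛-assoc g f h))

qPow : ℕ → PS
qPow e n = ifEq n e (+ 1)

shift≈qPow⊛ : ∀ e f → shift e f ≈ qPow e ⊛ f
shift≈qPow⊛ e f n with e ℕ.≤? n
... | yes e≤n = sym (trans (sumTo-single (suc n) e _ (s≤s e≤n) off)
      (trans (cong (ℤ._* f (n ∸ e)) (ifEq-≡ {e} {e} (+ 1) refl)) (ℤP.*-identityˡ _)))
  where
  off : ∀ i → i < suc n → ¬ i ≡ e → qPow e i ℤ.* f (n ∸ i) ≡ + 0
  off i _ i≢e = trans (cong (ℤ._* f (n ∸ i)) (ifEq-≢ (+ 1) i≢e)) (ℤP.*-zeroˡ (f (n ∸ i)))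
... | no e≰n = sym (sumTo-zero (suc n) λ i i<1+n →
  trans (cong (ℤ._* f (n ∸ i)) (ifEq-≢ (+ 1) (λ eq → e≰n (subst (_≤ n) eq (ℕP.≤-pred i<1+n)))))
        (ℤP.*-zeroˡ (f (n ∸ i))))

shift-below : ∀ d (f : PS) j → j < d → shift d f j ≡ + 0
shift-below d f j j<d with d ℕ.≤? j
... | yes d≤j = ⊥-elim (ℕP.<-irrefl refl (ℕP.<-≤-trans j<d d≤j))
... | no _ = refl

qPow-+ : ∀ a b → qPow (a ℕ.+ b) ≈ qPow a ⊛ qPow b
qPow-+ a b n = trans coefficient (shift≈qPow⊛ a (qPow b) n)
  where
  coefficient : qPow (a ℕ.+ b) n ≡ shift a (qPow b) n
  coefficient with a ℕ.≤? n
  ... | yes a≤n = by-cases (n ℕ.≟ a ℕ.+ b)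
    where
    by-cases : Dec (n ≡ a ℕ.+ b) → ifEq n (a ℕ.+ b) (+ 1) ≡ ifEq (n ∸ a) b (+ 1)
    by-cases (yes eq) = trans (ifEq-≡ (+ 1) eq)
      (sym (ifEq-≡ (+ 1) (trans (cong (_∸ a) eq) (ℕP.m+n∸m≡n a b))))
    by-cases (no n≢a+b) = trans (ifEq-≢ (+ 1) n≢a+b)
      (sym (ifEq-≢ (+ 1) λ eq → n≢a+b (trans (sym (ℕP.m+[n∸m]≡n a≤n)) (cong (a ℕ.+_) eq))))
  ... | no a≰n = ifEq-≢ (+ 1) λ eq → a≰n (subst (a ≤_) (sym eq) (ℕP.m≤m+n a b))

onePlus≈ : ∀ c d → onePlus c d ≈ one ⊕ scale c (qPow d)
onePlus≈ c d n = cong (λ z → ifEq n 0 (+ 1) ℤ.+ z)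
  (sym (trans (*-ifEq n d c (+ 1)) (cong (ifEq n d) (ℤP.*-identityʳ c))))

suc-*-overshoots : ∀ {n d j} → 1 ≤ d → d ≤ n → suc (n ∸ d) ≤ j → ¬ suc j ℕ.* d ≡ n
suc-*-overshoots {n} {d} {j} 1≤d d≤n lo eq = ℕP.<-irrefl refl (begin-strict
    n                   ≡⟨ sym (ℕP.m+[n∸m]≡n d≤n) ⟩
    d ℕ.+ (n ∸ d)       <⟨ ℕP.+-monoʳ-< d lo ⟩
    d ℕ.+ j             ≤⟨ ℕP.+-monoʳ-≤ d (ℕP.m≤m*n j d) ⟩
    d ℕ.+ j ℕ.* d       ≡⟨ eq ⟩
    n                   ∎)
  where
  open ℕP.≤-Reasoning
  instance _ = ℕ.>-nonZero 1≤d

geom-unfold : ∀ c d → 1 ≤ d → ∀ n → geom c d n ≡ one n ℤ.+ c ℤ.* shift d (geom c d) n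
geom-unfold c d 1≤d n =
  trans (sumTo-suc n _) (cong₂ ℤ._+_ (ifEq-cong-⇔ {0} {n} {n} {0} (+ 1) sym sym) tail)
  where
  tail : sumTo n (λ j → ifEq (suc j ℕ.* d) n (c ℤ.^ suc j)) ≡ c ℤ.* shift d (geom c d) n
  tail with d ℕ.≤? n
  ... | no d≰n = trans (sumTo-zero n λ j _ → ifEq-≢ _ λ eq → d≰n (subst (d ≤_) eq (ℕP.m≤m+n d (j ℕ.* d))))
                       (sym (ℤP.*-zeroʳ c))
  ... | yes d≤n = sym (begin
      c ℤ.* sumTo (suc (n ∸ d)) (λ j → ifEq (j ℕ.* d) (n ∸ d) (c ℤ.^ j))
    ≡⟨ *-distribˡ-sumTo (suc (n ∸ d)) c _ ⟩
      sumTo (suc (n ∸ d)) (λ j → c ℤ.* ifEq (j ℕ.* d) (n ∸ d) (c ℤ.^ j))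
    ≡⟨ sumTo-cong (suc (n ∸ d)) (λ j _ → trans (*-ifEq (j ℕ.* d) (n ∸ d) c (c ℤ.^ j))
          (ifEq-cong-⇔ _ (λ eq → trans (cong (d ℕ.+_) eq) (ℕP.m+[n∸m]≡n d≤n))
                         (λ eq → trans (sym (ℕP.m+n∸m≡n d (j ℕ.* d))) (cong (_∸ d) eq)))) ⟩
      sumTo (suc (n ∸ d)) (λ j → ifEq (suc j ℕ.* d) n (c ℤ.^ suc j))
    ≡⟨ sym (sumTo-extend (suc (n ∸ d)) n _ 1+n∸d≤n (λ j lo _ → ifEq-≢ _ (suc-*-overshoots 1≤d d≤n lo))) ⟩
      sumTo n (λ j → ifEq (suc j ℕ.* d) n (c ℤ.^ suc j))
    ∎)
    where
    open ≡-Reasoning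
    1+n∸d≤n : suc (n ∸ d) ≤ n
    1+n∸d≤n = subst (suc (n ∸ d) ≤_) (ℕP.m∸n+n≡m d≤n)
      (subst (_≤ (n ∸ d) ℕ.+ d) (ℕP.+-comm (n ∸ d) 1) (ℕP.+-monoʳ-≤ (n ∸ d) 1≤d))

onePlus⊛geom : ∀ c c' d → 1 ≤ d → c ℤ.+ c' ≡ + 0 → onePlus c' d ⊛ geom c d ≈ one
onePlus⊛geom c c' d 1≤d c+c'≡0 = begin
    onePlus c' d ⊛ g                      ≈⟨ ⊛-comm (onePlus c' d) g ⟩
    g ⊛ onePlus c' d                      ≈⟨ ⊛-congʳ g (onePlus≈ c' d) ⟩
    g ⊛ (one ⊕ scale c' (qPow d))         ≈⟨ ⊛-distribˡ-⊕ g one (scale c' (qPow d)) ⟩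
    (g ⊛ one) ⊕ (g ⊛ scale c' (qPow d))   ≈⟨ ⊕-cong (⊛-identityʳ g) (⊛-scaleʳ c' g (qPow d)) ⟩
    g ⊕ scale c' (g ⊛ qPow d)             ≈⟨ ⊕-cong (≈-refl {g}) (scale-cong c' (⊛-comm g (qPow d))) ⟩
    g ⊕ scale c' (qPow d ⊛ g)             ≈⟨ ⊕-cong (≈-refl {g}) (scale-cong c' (≈-sym (shift≈qPow⊛ d g))) ⟩
    g ⊕ scale c' (shift d g)              ≈⟨ telescope ⟩
    one                                   ∎
  where
  open ≈-Reasoning
  g = geom c d
  collect : ∀ o c c' s → (o ℤ.+ c ℤ.* s) ℤ.+ c' ℤ.* s ≡ o ℤ.+ (c ℤ.+ c') ℤ.* s
  collect = solve-∀
  telescope : g ⊕ scale c' (shift d g) ≈ one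
  telescope n = let s = shift d g n in
    trans (cong (ℤ._+ c' ℤ.* s) (geom-unfold c d 1≤d n))
      (trans (collect (one n) c c' s)
        (trans (cong (λ z → one n ℤ.+ z ℤ.* s) c+c'≡0) (ℤP.+-identityʳ (one n))))

prodTo-cong : ∀ N {F G : ℕ → PS} → (∀ i → i < N → F i ≈ G i) → prodTo N F ≈ prodTo N G
prodTo-cong zero h = ≈-refl {one}
prodTo-cong (suc N) h = ⊛-cong (prodTo-cong N (λ i i<N → h i (ℕP.m≤n⇒m≤1+n i<N))) (h N ℕP.≤-refl)

prodTo-one : ∀ N → prodTo N (λ _ → one) ≈ one
prodTo-one zero = ≈-refl {one}
prodTo-one (suc N) = ≈-trans (⊛-identityʳ (prodTo N (λ _ → one))) (prodTo-one N)

prodTo-⊛ : ∀ N (F G : ℕ → PS) → prodTo N F ⊛ prodTo N G ≈ prodTo N (λ i → F i ⊛ G i)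
prodTo-⊛ zero F G = ⊛-identityʳ one
prodTo-⊛ (suc N) F G = ≈-trans (⊛-interchange (prodTo N F) (F N) (prodTo N G) (G N))
  (⊛-congˡ (F N ⊛ G N) (prodTo-⊛ N F G))

prodTo-absorb : ∀ N (F G : ℕ → PS) X t → t < N → G t ≈ F t ⊛ X → (∀ i → i < N → ¬ i ≡ t → G i ≈ F i) →
  prodTo N F ⊛ X ≈ prodTo N G
prodTo-absorb (suc N) F G X t t<1+N at-t elsewhere with t ℕ.≟ N
... | yes refl = ≈-trans (⊛-assoc (prodTo N F) (F t) X)
  (⊛-cong (prodTo-cong N (λ i i<N → ≈-sym (elsewhere i (ℕP.m≤n⇒m≤1+n i<N) (ℕP.<⇒≢ i<N)))) (≈-sym at-t))
... | no t≢N = ≈-trans (⊛-swapʳ (prodTo N F) (F N) X)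
  (⊛-cong (prodTo-absorb N F G X t (ℕP.≤∧≢⇒< (ℕP.≤-pred t<1+N) t≢N) at-t
                         (λ i i<N → elsewhere i (ℕP.m≤n⇒m≤1+n i<N)))
          (≈-sym (elsewhere N ℕP.≤-refl (λ eq → t≢N (sym eq)))))

prodTo-stable : ∀ (F : ℕ → PS) → (∀ i j → j ≤ i → F i j ≡ one j) →
  ∀ n r j → j ≤ n → prodTo (n ℕ.+ r) F j ≡ prodTo n F j
prodTo-stable F F≡1 n zero j j≤n rewrite ℕP.+-identityʳ n = refl
prodTo-stable F F≡1 n (suc r) j j≤n rewrite ℕP.+-suc n r = trans
  (⊛-cong-upTo j {prodTo (n ℕ.+ r) F} {prodTo (n ℕ.+ r) F} (λ _ _ → refl)
     (λ i i≤j → F≡1 (n ℕ.+ r) i (ℕP.≤-trans i≤j (ℕP.≤-trans j≤n (ℕP.m≤m+n n r)))))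
  (trans (⊛-identityʳ (prodTo (n ℕ.+ r) F) j) (prodTo-stable F F≡1 n r j j≤n))

prodInf≡prodTo : ∀ (F : ℕ → PS) → (∀ i j → j ≤ i → F (suc i) j ≡ one j) →
  ∀ N j → j ≤ N → prodInf F j ≡ prodTo N (λ i → F (suc i)) j
prodInf≡prodTo F F≡1 N j j≤N = sym (trans
  (cong (λ M → prodTo M (λ i → F (suc i)) j) (sym (ℕP.m+[n∸m]≡n j≤N)))
  (prodTo-stable (λ i → F (suc i)) F≡1 j (N ∸ j) j ℕP.≤-refl))

onePlus≡one : ∀ c d j → j < d → onePlus c d j ≡ one j
onePlus≡one c d j j<d = trans (cong (λ z → one j ℤ.+ z) (ifEq-≢ c (ℕP.<⇒≢ j<d))) (ℤP.+-identityʳ (one j))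

geom≡one : ∀ c d j → 1 ≤ d → j < d → geom c d j ≡ one j
geom≡one c d j 1≤d j<d = trans (geom-unfold c d 1≤d j)
  (trans (cong (λ z → one j ℤ.+ c ℤ.* z) (shift-below d (geom c d) j j<d))
    (trans (cong (λ z → one j ℤ.+ z) (ℤP.*-zeroʳ c)) (ℤP.+-identityʳ (one j))))

-- (1 + q^t)/(1 - q^t), the generating function of the parts of size t, and its inverse.
freeGF freeGF⁻¹ : ℕ → PS
freeGF t = geom (+ 1) t ⊛ onePlus (+ 1) t
freeGF⁻¹ t = onePlus -[1+ 0 ] t ⊛ geom -[1+ 0 ] t

freeGF⊛freeGF⁻¹ : ∀ t → 1 ≤ t → freeGF t ⊛ freeGF⁻¹ t ≈ one
freeGF⊛freeGF⁻¹ t 1≤t = begin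
    (geom (+ 1) t ⊛ onePlus (+ 1) t) ⊛ (onePlus -[1+ 0 ] t ⊛ geom -[1+ 0 ] t)
  ≈⟨ ⊛-interchange (geom (+ 1) t) (onePlus (+ 1) t) (onePlus -[1+ 0 ] t) (geom -[1+ 0 ] t) ⟩
    (geom (+ 1) t ⊛ onePlus -[1+ 0 ] t) ⊛ (onePlus (+ 1) t ⊛ geom -[1+ 0 ] t)
  ≈⟨ ⊛-cong (≈-trans (⊛-comm (geom (+ 1) t) (onePlus -[1+ 0 ] t)) (onePlus⊛geom (+ 1) -[1+ 0 ] t 1≤t refl))
            (onePlus⊛geom -[1+ 0 ] (+ 1) t 1≤t refl) ⟩
    one ⊛ one
  ≈⟨ ⊛-identityʳ one ⟩
    one
  ∎
  where open ≈-Reasoning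

overpartitionGF≡prodTo : ∀ N j → j ≤ N → (minusQQ∞ ⊛ invQQ∞) j ≡ prodTo N (λ i → freeGF (suc i)) j
overpartitionGF≡prodTo N j j≤N = begin
    (minusQQ∞ ⊛ invQQ∞) j
  ≡⟨ ⊛-cong-upTo j {minusQQ∞} {prodTo N plus} {invQQ∞} {prodTo N geo}
       (λ i i≤j → prodInf≡prodTo (onePlus (+ 1)) (λ i' j' j'≤i' → onePlus≡one (+ 1) (suc i') j' (s≤s j'≤i'))
                    N i (ℕP.≤-trans i≤j j≤N))
       (λ i i≤j → prodInf≡prodTo (geom (+ 1)) (λ i' j' j'≤i' → geom≡one (+ 1) (suc i') j' (s≤s z≤n) (s≤s j'≤i'))
                    N i (ℕP.≤-trans i≤j j≤N)) ⟩
    (prodTo N plus ⊛ prodTo N geo) j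
  ≡⟨ prodTo-⊛ N plus geo j ⟩
    prodTo N (λ i → plus i ⊛ geo i) j
  ≡⟨ prodTo-cong N (λ i _ → ⊛-comm (plus i) (geo i)) j ⟩
    prodTo N (λ i → freeGF (suc i)) j
  ∎
  where
  open ≡-Reasoning
  plus geo : ℕ → PS
  plus i = onePlus (+ 1) (suc i)
  geo i = geom (+ 1) (suc i)

⊛-one⊖scale : ∀ c f h → f ⊛ (one ⊖ scale c h) ≈ f ⊖ scale c (f ⊛ h)
⊛-one⊖scale c f h = ≈-trans (⊛-distribˡ-⊖ f one (scale c h)) (⊖-cong (⊛-identityʳ f) (⊛-scaleʳ c f h))

-- This is how the two terms of a bracket combine into one quotient.
onePlus⊛geom-neg : ∀ d → 1 ≤ d →
  onePlus -[1+ 0 ] d ⊛ geom -[1+ 0 ] d ≈ one ⊖ scale (+ 2) (qPow d ⊛ geom -[1+ 0 ] d)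
onePlus⊛geom-neg d 1≤d = begin
    onePlus -[1+ 0 ] d ⊛ g                                  ≈⟨ ⊛-congˡ g 1-q≈1+q-2q ⟩
    (onePlus (+ 1) d ⊖ scale (+ 2) (qPow d)) ⊛ g            ≈⟨ ⊛-distribʳ-⊖ (onePlus (+ 1) d) (scale (+ 2) (qPow d)) g ⟩
    (onePlus (+ 1) d ⊛ g) ⊖ (scale (+ 2) (qPow d) ⊛ g)      ≈⟨ ⊖-cong (onePlus⊛geom -[1+ 0 ] (+ 1) d 1≤d refl)
                                                                      (⊛-scaleˡ (+ 2) (qPow d) g) ⟩
    one ⊖ scale (+ 2) (qPow d ⊛ g)                          ∎
  where
  open ≈-Reasoning
  g = geom -[1+ 0 ] d
  regroup : ∀ o m → o ℤ.+ -[1+ 0 ] ℤ.* m ≡ (o ℤ.+ + 1 ℤ.* m) ℤ.- + 2 ℤ.* m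
  regroup = solve-∀
  1-q≈1+q-2q : onePlus -[1+ 0 ] d ≈ onePlus (+ 1) d ⊖ scale (+ 2) (qPow d)
  1-q≈1+q-2q n = trans (onePlus≈ -[1+ 0 ] d n) (trans (regroup (one n) (qPow d n))
    (cong (ℤ._- (+ 2 ℤ.* qPow d n)) (sym (onePlus≈ (+ 1) d n))))

-- The generating function for a fixed value of mes

data Kind : Set where
  free once absent : Kind

kindGF : Kind → ℕ → PS
kindGF free   t = freeGF t
kindGF once   t = qPow t
kindGF absent t = one

≡ᵇ-true⇒≡ : ∀ {x y} → (x ℕ.≡ᵇ y) ≡ true → x ≡ y
≡ᵇ-true⇒≡ {x} {y} e = ℕP.≡ᵇ⇒≡ x y (subst T (sym e) tt)

module Progression (A a : ℕ) (1≤a : 1 ≤ a) (1≤A : 1 ≤ A) where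

  instance
    A-nonZero : ℕ.NonZero A
    A-nonZero = ℕ.>-nonZero 1≤A

  ap : ℕ → ℕ
  ap j = a ℕ.+ j ℕ.* A

  1≤ap : ∀ j → 1 ≤ ap j
  1≤ap j = ℕP.≤-trans 1≤a (ℕP.m≤m+n a (j ℕ.* A))

  ap-monoʳ-≤ : ∀ {i j} → i ≤ j → ap i ≤ ap j
  ap-monoʳ-≤ i≤j = ℕP.+-monoʳ-≤ a (ℕP.*-monoˡ-≤ A i≤j)

  ap-monoʳ-< : ∀ {i j} → i < j → ap i < ap j
  ap-monoʳ-< i<j = ℕP.+-monoʳ-< a (ℕP.*-monoˡ-< A i<j)

  ap-cancel-< : ∀ {i j} → ap i < ap j → i < j
  ap-cancel-< ap-i<ap-j = ℕP.*-cancelʳ-< A _ _ (ℕP.+-cancelˡ-< a _ _ ap-i<ap-j)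

  ap-injective : ∀ {i j} → ap i ≡ ap j → i ≡ j
  ap-injective {i} {j} eq = ℕP.*-cancelʳ-≡ i j A (ℕP.+-cancelˡ-≡ a _ _ eq)

  -- The exponent of the monomial in the k-th bracket: ap 0 + ... + ap (k-1).
  apSum : ℕ → ℕ
  apSum k = A ℕ.* (k C 2) ℕ.+ k ℕ.* a

  apSum-suc : ∀ k → apSum (suc k) ≡ apSum k ℕ.+ ap k
  apSum-suc k = begin
      A ℕ.* (suc k C 2) ℕ.+ suc k ℕ.* a
    ≡⟨ cong (λ z → A ℕ.* z ℕ.+ suc k ℕ.* a) (sym (trans (cong (ℕ._+ (k C 2)) (sym (nC1≡n k)))
                                                   (nCk+nC[k+1]≡[n+1]C[k+1] k 1))) ⟩
      A ℕ.* (k ℕ.+ k C 2) ℕ.+ (a ℕ.+ k ℕ.* a)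
    ≡⟨ regroup A k (k C 2) a ⟩
      (A ℕ.* (k C 2) ℕ.+ k ℕ.* a) ℕ.+ (a ℕ.+ k ℕ.* A)
    ∎
    where
    open ≡-Reasoning
    regroup : ∀ A k c a → A ℕ.* (k ℕ.+ c) ℕ.+ (a ℕ.+ k ℕ.* a) ≡ (A ℕ.* c ℕ.+ k ℕ.* a) ℕ.+ (a ℕ.+ k ℕ.* A)
    regroup = ℕSolver.solve-∀

  inAP : ℕ → ℕ → Bool
  inAP zero    t = false
  inAP (suc k) t = (t ℕ.≡ᵇ ap k) ∨ inAP k t

  inAP-sound : ∀ k t → inAP k t ≡ true → ∃[ j ] (j < k × t ≡ ap j)
  inAP-sound (suc k) t eq with t ℕ.≡ᵇ ap k in e
  ... | true = k , ℕP.≤-refl , ≡ᵇ-true⇒≡ e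
  ... | false with inAP-sound k t eq
  ...   | j , j<k , t≡ = j , ℕP.m≤n⇒m≤1+n j<k , t≡

  inAP-complete : ∀ k j → j < k → inAP k (ap j) ≡ true
  inAP-complete (suc k) j j<1+k with j ℕ.≟ k
  ... | yes refl rewrite dec-true (ap j ℕ.≟ ap j) refl = refl
  ... | no j≢k rewrite dec-false (ap j ℕ.≟ ap k) (λ eq → j≢k (ap-injective eq)) =
    inAP-complete k j (ℕP.≤∧≢⇒< (ℕP.≤-pred j<1+k) j≢k)

  inAP-ap : ∀ k → inAP k (ap k) ≡ false
  inAP-ap k with inAP k (ap k) in eq
  ... | false = refl
  ... | true with inAP-sound k (ap k) eq
  ...   | j , j<k , ap-k≡ = ⊥-elim (ℕP.<⇒≢ (ap-monoʳ-< j<k) (sym ap-k≡))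

  kindOf : ℕ → ℕ → Kind
  kindOf k t = if t ℕ.≡ᵇ ap k then absent else (if inAP k t then once else free)

  kindOf-cases : ∀ k t → (kindOf k t ≡ absent × t ≡ ap k)
                       ⊎ (kindOf k t ≡ once × ∃[ j ] (j < k × t ≡ ap j))
                       ⊎ kindOf k t ≡ free
  kindOf-cases k t with t ℕ.≡ᵇ ap k in e | inAP k t in e′
  ... | true | _ = inj₁ (refl , ≡ᵇ-true⇒≡ e)
  ... | false | true = inj₂ (inj₁ (refl , inAP-sound k t e′))
  ... | false | false = inj₂ (inj₂ refl)

  kindOf-ap : ∀ k → kindOf k (ap k) ≡ absent
  kindOf-ap k rewrite dec-true (ap k ℕ.≟ ap k) refl = refl

  kindOf-ap-< : ∀ k j → j < k → kindOf k (ap j) ≡ once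
  kindOf-ap-< k j j<k rewrite dec-false (ap j ℕ.≟ ap k) (ℕP.<⇒≢ (ap-monoʳ-< j<k))
    | inAP-complete k j j<k = refl

  selectAP : (ℕ → PS) → ℕ → ℕ → PS
  selectAP Y k t = if inAP k t then Y t else one

  prodTo-selectAP : ∀ N Y k → (∀ j → j < k → ap j ≤ N) →
    prodTo N (λ i → selectAP Y k (suc i)) ≈ prodTo k (λ j → Y (ap j))
  prodTo-selectAP N Y zero _ = prodTo-one N
  prodTo-selectAP N Y (suc k) ap≤N = ≈-trans
    (≈-sym (prodTo-absorb N (λ i → selectAP Y k (suc i)) (λ i → selectAP Y (suc k) (suc i)) (Y (ap k)) t t<N
             at-t elsewhere))
    (⊛-congˡ (Y (ap k)) (prodTo-selectAP N Y k (λ j j<k → ap≤N j (ℕP.m≤n⇒m≤1+n j<k))))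
    where
    t = ap k ∸ 1
    1+t≡ap : suc t ≡ ap k
    1+t≡ap = ℕP.m+[n∸m]≡n (1≤ap k)
    t<N : t < N
    t<N = subst (_≤ N) (sym 1+t≡ap) (ap≤N k ℕP.≤-refl)
    at-t : selectAP Y (suc k) (suc t) ≈ selectAP Y k (suc t) ⊛ Y (ap k)
    at-t rewrite 1+t≡ap | dec-true (ap k ℕ.≟ ap k) refl | inAP-ap k = ≈-sym (⊛-identityˡ (Y (ap k)))
    elsewhere : ∀ i → i < N → ¬ i ≡ t → selectAP Y (suc k) (suc i) ≈ selectAP Y k (suc i)
    elsewhere i _ i≢t rewrite dec-false (suc i ℕ.≟ ap k) (λ eq → i≢t (ℕP.suc-injective (trans eq (sym 1+t≡ap)))) =
      ≈-refl {selectAP Y k (suc i)}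

  kindGF≈ : ∀ k t → 1 ≤ t →
    kindGF (kindOf k t) t ≈ freeGF t ⊛ (selectAP qPow k t ⊛ selectAP freeGF⁻¹ (suc k) t)
  kindGF≈ k t 1≤t with t ℕ.≡ᵇ ap k in e | inAP k t in e′
  ... | true | true = ⊥-elim (true≢false (trans (sym e′) (trans (cong (inAP k) (≡ᵇ-true⇒≡ e)) (inAP-ap k))))
    where
    true≢false : true ≡ false → ⊥
    true≢false ()
  ... | true | false = ≈-sym (≈-trans (⊛-congʳ (freeGF t) (⊛-identityˡ (freeGF⁻¹ t))) (freeGF⊛freeGF⁻¹ t 1≤t))
  ... | false | true = ≈-sym (begin
      freeGF t ⊛ (qPow t ⊛ freeGF⁻¹ t)   ≈⟨ ⊛-rotate (freeGF t) (qPow t) (freeGF⁻¹ t) ⟩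
      qPow t ⊛ (freeGF t ⊛ freeGF⁻¹ t)   ≈⟨ ⊛-congʳ (qPow t) (freeGF⊛freeGF⁻¹ t 1≤t) ⟩
      qPow t ⊛ one                       ≈⟨ ⊛-identityʳ (qPow t) ⟩
      qPow t                             ∎)
    where open ≈-Reasoning
  ... | false | false = ≈-sym (≈-trans (⊛-congʳ (freeGF t) (⊛-identityʳ one)) (⊛-identityʳ (freeGF t)))

  prodTo-qPow-ap : ∀ k → prodTo k (λ j → qPow (ap j)) ≈ qPow (apSum k)
  prodTo-qPow-ap zero n rewrite ℕP.*-zeroʳ A = refl
  prodTo-qPow-ap (suc k) = ≈-trans (⊛-congˡ (qPow (ap k)) (prodTo-qPow-ap k))
    (≈-trans (≈-sym (qPow-+ (apSum k) (ap k))) (λ n → cong (λ e → qPow e n) (sym (apSum-suc k))))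

  -- ∏_{j<k} (1 - q^{ap j})/(1 + q^{ap j}) = (q^a;q^A)_k/(-q^a;q^A)_k
  pochRatio : ℕ → PS
  pochRatio k = prodTo k (λ j → freeGF⁻¹ (ap j))

  prodTo-kindGF : ∀ N k → ap k ≤ N →
    prodTo N (λ i → kindGF (kindOf k (suc i)) (suc i))
      ≈ prodTo N (λ i → freeGF (suc i)) ⊛ (qPow (apSum k) ⊛ pochRatio (suc k))
  prodTo-kindGF N k ap-k≤N = begin
      prodTo N (λ i → kindGF (kindOf k (suc i)) (suc i))
    ≈⟨ prodTo-cong N (λ i _ → kindGF≈ k (suc i) (s≤s z≤n)) ⟩
      prodTo N (λ i → freeGF (suc i) ⊛ (select qPow k i ⊛ select freeGF⁻¹ (suc k) i))
    ≈⟨ ≈-sym (prodTo-⊛ N (λ i → freeGF (suc i)) _) ⟩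
      Free ⊛ prodTo N (λ i → select qPow k i ⊛ select freeGF⁻¹ (suc k) i)
    ≈⟨ ⊛-congʳ Free (≈-sym (prodTo-⊛ N (select qPow k) (select freeGF⁻¹ (suc k)))) ⟩
      Free ⊛ (prodTo N (select qPow k) ⊛ prodTo N (select freeGF⁻¹ (suc k)))
    ≈⟨ ⊛-congʳ Free (⊛-cong
         (≈-trans (prodTo-selectAP N qPow k (λ j j<k → ap≤N j (ℕP.<⇒≤ j<k))) (prodTo-qPow-ap k))
         (prodTo-selectAP N freeGF⁻¹ (suc k) (λ j j<1+k → ap≤N j (ℕP.≤-pred j<1+k)))) ⟩
      Free ⊛ (qPow (apSum k) ⊛ pochRatio (suc k))
    ∎
    where
    open ≈-Reasoning
    Free = prodTo N (λ i → freeGF (suc i))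
    select : (ℕ → PS) → ℕ → ℕ → PS
    select Y k i = selectAP Y k (suc i)
    ap≤N : ∀ j → j ≤ k → ap j ≤ N
    ap≤N j j≤k = ℕP.≤-trans (ap-monoʳ-≤ j≤k) ap-k≤N

  bracket≈ : ∀ k → bracket A a k ≈ qPow (apSum k) ⊛ pochRatio (suc k)
  bracket≈ k = ≈-sym (begin
      qPow e ⊛ pochRatio (suc k)
    ≈⟨ ⊛-congʳ (qPow e) (≈-sym (prodTo-⊛ (suc k) (λ i → onePlus -[1+ 0 ] (ap i)) (λ i → geom -[1+ 0 ] (ap i)))) ⟩
      qPow e ⊛ ((qP ⊛ p) ⊛ (iN ⊛ g))
    ≈⟨ ⊛-congʳ (qPow e) (≈-trans (⊛-interchange qP p iN g) (⊛-congʳ X (onePlus⊛geom-neg (ap k) (1≤ap k)))) ⟩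
      qPow e ⊛ (X ⊛ (one ⊖ scale (+ 2) (qPow (ap k) ⊛ g)))
    ≈⟨ ⊛-congʳ (qPow e) (⊛-one⊖scale (+ 2) X (qPow (ap k) ⊛ g)) ⟩
      qPow e ⊛ (X ⊖ scale (+ 2) (X ⊛ (qPow (ap k) ⊛ g)))
    ≈⟨ ⊛-distribˡ-⊖ (qPow e) X (scale (+ 2) (X ⊛ (qPow (ap k) ⊛ g))) ⟩
      (qPow e ⊛ X) ⊖ (qPow e ⊛ scale (+ 2) (X ⊛ (qPow (ap k) ⊛ g)))
    ≈⟨ ⊖-cong (≈-sym (shift≈qPow⊛ e X))
              (≈-trans (⊛-scaleʳ (+ 2) (qPow e) (X ⊛ (qPow (ap k) ⊛ g))) (scale-cong (+ 2) shifted)) ⟩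
      bracket A a k
    ∎)
    where
    open ≈-Reasoning
    e = apSum k
    qP = qPoch a A k
    iN = invNegPoch a A k
    p = onePlus -[1+ 0 ] (ap k)
    g = geom -[1+ 0 ] (ap k)
    X = qP ⊛ iN
    shifted : qPow e ⊛ (X ⊛ (qPow (ap k) ⊛ g)) ≈ shift (apSum (suc k)) (qP ⊛ (iN ⊛ g))
    shifted = ≈-sym (begin
        shift (apSum (suc k)) (qP ⊛ (iN ⊛ g))
      ≈⟨ shift≈qPow⊛ (apSum (suc k)) (qP ⊛ (iN ⊛ g)) ⟩
        qPow (apSum (suc k)) ⊛ (qP ⊛ (iN ⊛ g))
      ≈⟨ ⊛-congˡ (qP ⊛ (iN ⊛ g)) (≈-trans (λ n → cong (λ z → qPow z n) (apSum-suc k)) (qPow-+ e (ap k))) ⟩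
        (qPow e ⊛ qPow (ap k)) ⊛ (qP ⊛ (iN ⊛ g))
      ≈⟨ ⊛-assoc (qPow e) (qPow (ap k)) (qP ⊛ (iN ⊛ g)) ⟩
        qPow e ⊛ (qPow (ap k) ⊛ (qP ⊛ (iN ⊛ g)))
      ≈⟨ ⊛-congʳ (qPow e) (≈-trans (⊛-congʳ (qPow (ap k)) (≈-sym (⊛-assoc qP iN g)))
                                    (⊛-rotate (qPow (ap k)) X g)) ⟩
        qPow e ⊛ (X ⊛ (qPow (ap k) ⊛ g))
      ∎)

  -- Only sizes ≤ N matter for coefficients up to q^N.
  rhsTerm≡prodTo-kindGF : ∀ N k n → n ≤ N → ap k ≤ N →
    (minusQQ∞ ⊛ invQQ∞ ⊛ bracket A a k) n ≡ prodTo N (λ i → kindGF (kindOf k (suc i)) (suc i)) n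
  rhsTerm≡prodTo-kindGF N k n n≤N ap-k≤N = begin
      (Over ⊛ bracket A a k) n
    ≡⟨ ⊛-congʳ Over (bracket≈ k) n ⟩
      (Over ⊛ (qPow (apSum k) ⊛ R)) n
    ≡⟨ ⊛-rotate Over (qPow (apSum k)) R n ⟩
      (qPow (apSum k) ⊛ (Over ⊛ R)) n
    ≡⟨ ⊛-cong-upTo n {qPow (apSum k)} (λ _ _ → refl) (λ j j≤n → ⊛-cong-upTo j {Over} {Free} {R}
         (λ i i≤j → overpartitionGF≡prodTo N i (ℕP.≤-trans i≤j (ℕP.≤-trans j≤n n≤N))) (λ _ _ → refl)) ⟩
      (qPow (apSum k) ⊛ (Free ⊛ R)) n
    ≡⟨ ⊛-rotate (qPow (apSum k)) Free R n ⟩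
      (Free ⊛ (qPow (apSum k) ⊛ R)) n
    ≡⟨ sym (prodTo-kindGF N k ap-k≤N n) ⟩
      prodTo N (λ i → kindGF (kindOf k (suc i)) (suc i)) n
    ∎
    where
    open ≡-Reasoning
    Over = minusQQ∞ ⊛ invQQ∞
    R = pochRatio (suc k)
    Free = prodTo N (λ i → freeGF (suc i))

-- Enumerating graded classes of lists

module _ {B : Set} where

  concatUpTo : ℕ → (ℕ → List B) → List B
  concatUpTo zero    f = []
  concatUpTo (suc n) f = concatUpTo n f ++ f n

  singletonIf : ℕ → ℕ → B → List B
  singletonIf w m x with w ℕ.≟ m
  ... | yes _ = x ∷ []
  ... | no  _ = []

  length-concatUpTo : ∀ n f → + length (concatUpTo n f) ≡ sumTo n (λ i → + length (f i))
  length-concatUpTo zero f = refl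
  length-concatUpTo (suc n) f rewrite ListP.length-++ (concatUpTo n f) {f n} =
    trans (ℤP.pos-+ (length (concatUpTo n f)) (length (f n))) (cong (ℤ._+ + length (f n)) (length-concatUpTo n f))

  length-singletonIf : ∀ w m x → + length (singletonIf w m x) ≡ ifEq w m (+ 1)
  length-singletonIf w m x with w ℕ.≟ m
  ... | yes _ = refl
  ... | no  _ = refl

  ∈-singletonIf⁻ : ∀ {w m x z} → z ∈ singletonIf w m x → w ≡ m × z ≡ x
  ∈-singletonIf⁻ {w} {m} p with w ℕ.≟ m
  ∈-singletonIf⁻ (here refl) | yes w≡m = w≡m , refl

  ∈-singletonIf⁺ : ∀ w m x → w ≡ m → x ∈ singletonIf w m x
  ∈-singletonIf⁺ w m x w≡m with w ℕ.≟ m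
  ... | yes _ = here refl
  ... | no w≢m = ⊥-elim (w≢m w≡m)

  singletonIf-unique : ∀ w m x → Unique (singletonIf w m x)
  singletonIf-unique w m x with w ℕ.≟ m
  ... | yes _ = [] ∷ []
  ... | no  _ = []

  ∈-concatUpTo⁻ : ∀ n f {z} → z ∈ concatUpTo n f → ∃[ i ] (i < n × z ∈ f i)
  ∈-concatUpTo⁻ (suc n) f p with ∈-++⁻ (concatUpTo n f) p
  ... | inj₂ q = n , ℕP.≤-refl , q
  ... | inj₁ q with ∈-concatUpTo⁻ n f q
  ...   | i , i<n , r = i , ℕP.m≤n⇒m≤1+n i<n , r

  ∈-concatUpTo⁺ : ∀ n f {z i} → i < n → z ∈ f i → z ∈ concatUpTo n f
  ∈-concatUpTo⁺ (suc n) f {i = i} i<1+n p with i ℕ.≟ n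
  ... | yes refl = ∈-++⁺ʳ (concatUpTo n f) p
  ... | no i≢n = ∈-++⁺ˡ (∈-concatUpTo⁺ n f (ℕP.≤∧≢⇒< (ℕP.≤-pred i<1+n) i≢n) p)

  concatUpTo-unique : ∀ n f → (∀ i → Unique (f i)) → (∀ {i j z} → z ∈ f i → z ∈ f j → i ≡ j) →
    Unique (concatUpTo n f)
  concatUpTo-unique zero f u disjoint = []
  concatUpTo-unique (suc n) f u disjoint =
    UniqueP.++⁺ (concatUpTo-unique n f u disjoint) (u n) λ (p , q) → apart p q
    where
    apart : ∀ {z} → z ∈ concatUpTo n f → z ∈ f n → ⊥
    apart p q with ∈-concatUpTo⁻ n f p
    ... | i , i<n , r = ℕP.<⇒≢ i<n (disjoint r q)

  concatMap-unique : ∀ {C : Set} (f : C → List B) xs → Unique xs → (∀ x → Unique (f x)) →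
    (∀ {x x' z} → x ∈ xs → x' ∈ xs → z ∈ f x → z ∈ f x' → x ≡ x') → Unique (concatMap f xs)
  concatMap-unique f [] _ u disjoint = []
  concatMap-unique f (x ∷ xs) (x∉xs ∷ uxs) u disjoint =
    UniqueP.++⁺ (u x) (concatMap-unique f xs uxs u (λ p p' → disjoint (there p) (there p'))) λ (p , q) → apart p q
    where
    apart : ∀ {z} → z ∈ f x → z ∈ concatMap f xs → ⊥
    apart p q with find (∈-concatMap⁻ f q)
    ... | y , y∈xs , r = lookup x∉xs y∈xs (disjoint (here refl) (there y∈xs) p r)

  length-concatMap-const : ∀ {C : Set} (f : C → List B) xs k → (∀ x → length (f x) ≡ k) →
    length (concatMap f xs) ≡ length xs ℕ.* k
  length-concatMap-const f [] k h = refl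
  length-concatMap-const f (x ∷ xs) k h
    rewrite ListP.length-++ (f x) {concatMap f xs} | h x | length-concatMap-const f xs k h = refl

-- A graded class lists, for every weight w, the objects of weight w.
Graded : Set
Graded = ℕ → List (List Part)

count : Graded → PS
count E w = + length (E w)

Weighted : Graded → Set
Weighted E = ∀ {w x} → x ∈ E w → weight x ≡ w

weight-++ : ∀ y x → weight (y ++ x) ≡ weight y ℕ.+ weight x
weight-++ y x rewrite ListP.map-++ size y x = sum-++ (map size y) (map size x)

_⊗_ : Graded → Graded → Graded
(E₁ ⊗ E₂) w = concatUpTo (suc w) λ i → concatMap (λ x → map (_++ x) (E₂ (w ∸ i))) (E₁ i)

count-⊗ : ∀ E₁ E₂ → count (E₁ ⊗ E₂) ≈ count E₁ ⊛ count E₂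
count-⊗ E₁ E₂ w = trans (length-concatUpTo (suc w) _) (sumTo-cong (suc w) λ i _ →
  trans (cong +_ (length-concatMap-const (λ x → map (_++ x) (E₂ (w ∸ i))) (E₁ i) (length (E₂ (w ∸ i)))
                    (λ x → ListP.length-map (_++ x) (E₂ (w ∸ i)))))
        (ℤP.pos-* (length (E₁ i)) (length (E₂ (w ∸ i)))))

∈-⊗⁻ : ∀ E₁ E₂ w {z} → z ∈ (E₁ ⊗ E₂) w →
  ∃[ i ] ∃[ x ] ∃[ y ] (i ≤ w × x ∈ E₁ i × y ∈ E₂ (w ∸ i) × z ≡ y ++ x)
∈-⊗⁻ E₁ E₂ w p with ∈-concatUpTo⁻ (suc w) _ p
... | i , i<1+w , q with find (∈-concatMap⁻ _ q)
...   | x , x∈ , r with ∈-map⁻ (_++ x) r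
...     | y , y∈ , z≡ = i , x , y , ℕP.≤-pred i<1+w , x∈ , y∈ , z≡

∈-⊗⁺ : ∀ E₁ E₂ w {i x y} → i ≤ w → x ∈ E₁ i → y ∈ E₂ (w ∸ i) → y ++ x ∈ (E₁ ⊗ E₂) w
∈-⊗⁺ E₁ E₂ w {x = x} i≤w x∈ y∈ =
  ∈-concatUpTo⁺ (suc w) _ (s≤s i≤w) (∈-concatMap⁺ _ (lose x∈ (∈-map⁺ (_++ x) y∈)))

⊗-unique : ∀ E₁ E₂ → (∀ i → Unique (E₁ i)) → (∀ j → Unique (E₂ j)) → Weighted E₁ →
  (∀ {i i' j j' x x' y y'} → x ∈ E₁ i → x' ∈ E₁ i' → y ∈ E₂ j → y' ∈ E₂ j' →
     y ++ x ≡ y' ++ x' → y ≡ y') →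
  ∀ w → Unique ((E₁ ⊗ E₂) w)
⊗-unique E₁ E₂ u₁ u₂ weighted split w = concatUpTo-unique (suc w) _
  (λ i → concatMap-unique _ (E₁ i) (u₁ i)
           (λ x → UniqueP.map⁺ (λ {y} {y'} eq → ListP.++-cancelʳ x y y' eq) (u₂ (w ∸ i)))
           (λ x∈ x'∈ z∈ z∈' → proj₁ (same-split x∈ x'∈ z∈ z∈')))
  across
  where
  same-split : ∀ {i i' x x' z} → x ∈ E₁ i → x' ∈ E₁ i' →
    z ∈ map (_++ x) (E₂ (w ∸ i)) → z ∈ map (_++ x') (E₂ (w ∸ i')) → x ≡ x' × i ≡ i'
  same-split {x = x} {x'} x∈ x'∈ z∈ z∈' with ∈-map⁻ (_++ x) z∈ | ∈-map⁻ (_++ x') z∈'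
  ... | y , y∈ , refl | y' , y'∈ , eq with split x∈ x'∈ y∈ y'∈ eq
  ...   | refl = x≡x' , trans (sym (weighted x∈)) (trans (cong weight x≡x') (weighted x'∈))
    where x≡x' = ListP.++-cancelˡ y x x' eq
  across : ∀ {i j z} → z ∈ concatMap (λ x → map (_++ x) (E₂ (w ∸ i))) (E₁ i) →
                       z ∈ concatMap (λ x → map (_++ x) (E₂ (w ∸ j))) (E₁ j) → i ≡ j
  across p q with find (∈-concatMap⁻ _ p) | find (∈-concatMap⁻ _ q)
  ... | x , x∈ , r | x' , x'∈ , r' = proj₂ (same-split x∈ x'∈ r r')

-- Overpartitions with prescribed behaviour at each size

optionalOverlined : ℕ → Graded
optionalOverlined t w = singletonIf w 0 [] ++ singletonIf w t ((t , true) ∷ [])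

plainCopies : ℕ → ℕ → List Part
plainCopies j t = replicate j (t , false)

nonOverlined : ℕ → Graded
nonOverlined t w = concatUpTo (suc w) λ j → singletonIf (j ℕ.* t) w (plainCopies j t)

block : Kind → ℕ → Graded
block free   t = nonOverlined t ⊗ optionalOverlined t
block once   t w = singletonIf w t ((t , true) ∷ [])
block absent t w = singletonIf w 0 []

enumerate : (ℕ → Kind) → ℕ → Graded
enumerate κ zero    w = singletonIf w 0 []
enumerate κ (suc N) = enumerate κ N ⊗ block (κ (suc N)) (suc N)

count-optionalOverlined : ∀ t → count (optionalOverlined t) ≈ onePlus (+ 1) t
count-optionalOverlined t w =
  trans (cong +_ (ListP.length-++ (singletonIf w 0 ([] {A = Part})) {singletonIf w t ((t , true) ∷ [])}))
  (trans (ℤP.pos-+ (length (singletonIf w 0 ([] {A = Part}))) (length (singletonIf w t ((t , true) ∷ []))))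
    (cong₂ ℤ._+_ (length-singletonIf w 0 []) (length-singletonIf w t ((t , true) ∷ []))))

count-nonOverlined : ∀ t → count (nonOverlined t) ≈ geom (+ 1) t
count-nonOverlined t w = trans (length-concatUpTo (suc w) _) (sumTo-cong (suc w) λ j _ →
  trans (length-singletonIf (j ℕ.* t) w _) (cong (ifEq (j ℕ.* t) w) (sym (ℤP.^-zeroˡ j))))

count-block : ∀ κ t → count (block κ t) ≈ kindGF κ t
count-block free t w = trans (count-⊗ (nonOverlined t) (optionalOverlined t) w)
  (⊛-cong (count-nonOverlined t) (count-optionalOverlined t) w)
count-block once   t w = length-singletonIf w t _
count-block absent t w = length-singletonIf w 0 _

count-enumerate : ∀ κ N → count (enumerate κ N) ≈ prodTo N (λ i → kindGF (κ (suc i)) (suc i))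
count-enumerate κ zero w = length-singletonIf w 0 _
count-enumerate κ (suc N) w = trans (count-⊗ (enumerate κ N) (block (κ (suc N)) (suc N)) w)
  (⊛-cong (count-enumerate κ N) (count-block (κ (suc N)) (suc N)) w)

NextPart⇒size-≥ : ∀ {p q} → NextPart p q → size q ≤ size p
NextPart⇒size-≥ (inj₁ t<s) = ℕP.<⇒≤ t<s
NextPart⇒size-≥ (inj₂ (refl , _)) = ℕP.≤-refl

Linked⇒All-size-≤ : ∀ {p π} → Linked NextPart (p ∷ π) → All (λ q → size q ≤ size p) π
Linked⇒All-size-≤ [-] = []
Linked⇒All-size-≤ {p} {q ∷ π} (p→q ∷ rest) = NextPart⇒size-≥ {p} {q} p→q ∷
  All.map (λ r≤q → ℕP.≤-trans r≤q (NextPart⇒size-≥ {p} {q} p→q)) (Linked⇒All-size-≤ rest)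

Linked-++⁻ʳ : ∀ y {x} → Linked NextPart (y ++ x) → Linked NextPart x
Linked-++⁻ʳ []      l = l
Linked-++⁻ʳ (p ∷ y) l = Linked-++⁻ʳ y (Linked.tail l)

Linked-++⁻ˡ : ∀ y {x} → Linked NextPart (y ++ x) → Linked NextPart y
Linked-++⁻ˡ []          l = []
Linked-++⁻ˡ (p ∷ [])     l = [-]
Linked-++⁻ˡ (p ∷ q ∷ y) (r ∷ l) = r ∷ Linked-++⁻ˡ (q ∷ y) l

Linked-++⁺ : ∀ {t} y x → Linked NextPart y → All (λ p → size p ≡ t) y →
  Linked NextPart x → All (λ p → size p < t) x → Linked NextPart (y ++ x)
Linked-++⁺ [] x ly ay lx ax = lx
Linked-++⁺ (p ∷ []) [] ly ay lx ax = [-]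
Linked-++⁺ (p ∷ []) (q ∷ x) ly (refl ∷ []) lx (q<t ∷ ax) = inj₁ q<t ∷ lx
Linked-++⁺ (p ∷ p' ∷ y) x (r ∷ ly) (_ ∷ ay) lx ax = r ∷ Linked-++⁺ (p' ∷ y) x ly ay lx ax

split-at-size : ∀ t π → All (λ p → size p ≤ t) π → Linked NextPart π →
  ∃[ y ] ∃[ x ] (π ≡ y ++ x × All (λ p → size p ≡ t) y × All (λ p → size p < t) x)
split-at-size t [] _ _ = [] , [] , refl , [] , []
split-at-size t (p ∷ π) (p≤t ∷ π≤t) l with size p ℕ.≟ t
... | yes p≡t with split-at-size t π π≤t (Linked.tail l)
...   | y , x , refl , ay , ax = p ∷ y , x , refl , p≡t ∷ ay , ax
split-at-size t (p ∷ π) (p≤t ∷ π≤t) l | no p≢t =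
  [] , p ∷ π , refl , [] , (p<t ∷ All.map (λ q≤p → ℕP.≤-<-trans q≤p p<t) (Linked⇒All-size-≤ l))
  where p<t = ℕP.≤∧≢⇒< p≤t p≢t

split-injective : ∀ {t} y y' {x x'} → All (λ p → size p ≡ t) y → All (λ p → size p ≡ t) y' →
  All (λ p → size p < t) x → All (λ p → size p < t) x' → y ++ x ≡ y' ++ x' → y ≡ y'
split-injective [] [] _ _ _ _ _ = refl
split-injective [] (q ∷ y') _ (refl ∷ _) (q<t ∷ _) _ refl = ⊥-elim (ℕP.<-irrefl refl q<t)
split-injective (p ∷ y) [] (refl ∷ _) _ _ (p<t ∷ _) refl = ⊥-elim (ℕP.<-irrefl refl p<t)
split-injective (p ∷ y) (q ∷ y') (_ ∷ ay) (_ ∷ ay') ax ax' eq =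
  cong₂ _∷_ (ListP.∷-injectiveˡ eq) (split-injective y y' ay ay' ax ax' (ListP.∷-injectiveʳ eq))

∈-++-by-size : ∀ {t t' b} y x → All (λ p → size p ≡ t) y → All (λ p → size p < t) x → (t' , b) ∈ y ++ x →
  ((t' , b) ∈ y × t' ≡ t) ⊎ ((t' , b) ∈ x × t' < t)
∈-++-by-size y x ay ax p with ∈-++⁻ y p
... | inj₁ q = inj₁ (q , lookup ay q)
... | inj₂ q = inj₂ (q , lookup ax q)

∈-optionalOverlined⁻ : ∀ t w {o} → o ∈ optionalOverlined t w →
  (o ≡ [] × w ≡ 0) ⊎ (o ≡ (t , true) ∷ [] × w ≡ t)
∈-optionalOverlined⁻ t w p with ∈-++⁻ (singletonIf w 0 []) p
... | inj₁ q with ∈-singletonIf⁻ q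
...   | w≡0 , refl = inj₁ (refl , w≡0)
∈-optionalOverlined⁻ t w p | inj₂ q with ∈-singletonIf⁻ q
...   | w≡t , refl = inj₂ (refl , w≡t)

∈-nonOverlined⁻ : ∀ t w {r} → r ∈ nonOverlined t w → ∃[ j ] (r ≡ plainCopies j t × j ℕ.* t ≡ w)
∈-nonOverlined⁻ t w p with ∈-concatUpTo⁻ (suc w) _ p
... | j , _ , q with ∈-singletonIf⁻ q
...   | j*t≡w , refl = j , refl , j*t≡w

weight-plainCopies : ∀ j t → weight (plainCopies j t) ≡ j ℕ.* t
weight-plainCopies zero    t = refl
weight-plainCopies (suc j) t = cong (t ℕ.+_) (weight-plainCopies j t)

plainCopies-size : ∀ j t → All (λ p → size p ≡ t) (plainCopies j t)
plainCopies-size zero    t = []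
plainCopies-size (suc j) t = refl ∷ plainCopies-size j t

plainCopies-linked : ∀ j t → Linked NextPart (plainCopies j t)
plainCopies-linked zero          t = []
plainCopies-linked (suc zero)    t = [-]
plainCopies-linked (suc (suc j)) t = inj₂ (refl , refl) ∷ plainCopies-linked (suc j) t

overlined∷plainCopies-linked : ∀ j t → Linked NextPart ((t , true) ∷ plainCopies j t)
overlined∷plainCopies-linked zero    t = [-]
overlined∷plainCopies-linked (suc j) t = inj₂ (refl , refl) ∷ plainCopies-linked (suc j) t

BlockShape : Kind → ℕ → List Part → Set
BlockShape free   t y = ⊤
BlockShape once   t y = y ≡ (t , true) ∷ []
BlockShape absent t y = y ≡ []

Obeys : Kind → ℕ → List Part → Set
Obeys free   t π = ⊤
Obeys once   t π = HasSize π t × (∀ b → (t , b) ∈ π → b ≡ true)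
Obeys absent t π = ¬ HasSize π t

Admissible : (ℕ → Kind) → ℕ → ℕ → List Part → Set
Admissible κ N w π = IsOverpartition π × All (λ p → size p ≤ N) π × weight π ≡ w ×
  (∀ t → 1 ≤ t → t ≤ N → Obeys (κ t) t π)

block-sound : ∀ κ t w {y} → y ∈ block κ t w →
  All (λ p → size p ≡ t) y × Linked NextPart y × weight y ≡ w × BlockShape κ t y
block-sound free t w p with ∈-⊗⁻ (nonOverlined t) (optionalOverlined t) w p
... | i , r , o , i≤w , r∈ , o∈ , refl with ∈-nonOverlined⁻ t i r∈ | ∈-optionalOverlined⁻ t (w ∸ i) o∈
...   | j , refl , j*t≡i | inj₁ (refl , w∸i≡0) =
  plainCopies-size j t , plainCopies-linked j t ,
  trans (weight-plainCopies j t) (trans j*t≡i (trans (cong (ℕ._+ i) (sym w∸i≡0)) (ℕP.m∸n+n≡m i≤w))) , tt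
...   | j , refl , j*t≡i | inj₂ (refl , w∸i≡t) =
  refl ∷ plainCopies-size j t , overlined∷plainCopies-linked j t ,
  trans (cong₂ ℕ._+_ (sym w∸i≡t) (trans (weight-plainCopies j t) j*t≡i)) (ℕP.m∸n+n≡m i≤w) , tt
block-sound once t w p with ∈-singletonIf⁻ p
... | w≡t , refl = refl ∷ [] , [-] , trans (ℕP.+-identityʳ t) (sym w≡t) , refl
block-sound absent t w p with ∈-singletonIf⁻ p
... | w≡0 , refl = [] , [] , sym w≡0 , refl

plainCopies≢overlined∷ : ∀ j t z → ¬ plainCopies j t ≡ (t , true) ∷ z
plainCopies≢overlined∷ zero    t z ()
plainCopies≢overlined∷ (suc j) t z ()

nonOverlined-unique : ∀ t w → Unique (nonOverlined t w)
nonOverlined-unique t w =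
  concatUpTo-unique (suc w) _ (λ j → singletonIf-unique (j ℕ.* t) w (plainCopies j t)) disjoint
  where
  disjoint : ∀ {i j z} → z ∈ singletonIf (i ℕ.* t) w (plainCopies i t) →
             z ∈ singletonIf (j ℕ.* t) w (plainCopies j t) → i ≡ j
  disjoint p q with ∈-singletonIf⁻ p | ∈-singletonIf⁻ q
  ... | _ , refl | _ , z≡ =
    trans (sym (ListP.length-replicate _)) (trans (cong length z≡) (ListP.length-replicate _))

optionalOverlined-unique : ∀ t w → Unique (optionalOverlined t w)
optionalOverlined-unique t w =
  UniqueP.++⁺ (singletonIf-unique w 0 []) (singletonIf-unique w t _) λ (p , q) → apart p q
  where
  apart : ∀ {z} → z ∈ singletonIf w 0 [] → z ∈ singletonIf w t ((t , true) ∷ []) → ⊥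
  apart p q with ∈-singletonIf⁻ p | ∈-singletonIf⁻ q
  ... | _ , refl | _ , ()

nonOverlined-weighted : ∀ t {i x} → x ∈ nonOverlined t i → weight x ≡ i
nonOverlined-weighted t {i} p with ∈-nonOverlined⁻ t i p
... | j , refl , j*t≡i = trans (weight-plainCopies j t) j*t≡i

optional-plain-split : ∀ t {i i' j j' x x' y y'} → x ∈ nonOverlined t i → x' ∈ nonOverlined t i' →
  y ∈ optionalOverlined t j → y' ∈ optionalOverlined t j' → y ++ x ≡ y' ++ x' → y ≡ y'
optional-plain-split t {i} {i'} {j} {j'} x∈ x'∈ y∈ y'∈ eq
  with ∈-nonOverlined⁻ t i x∈ | ∈-nonOverlined⁻ t i' x'∈
     | ∈-optionalOverlined⁻ t j y∈ | ∈-optionalOverlined⁻ t j' y'∈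
... | _ | _ | inj₁ (refl , _) | inj₁ (refl , _) = refl
... | _ | _ | inj₂ (refl , _) | inj₂ (refl , _) = refl
... | k , refl , _ | _ | inj₁ (refl , _) | inj₂ (refl , _) = ⊥-elim (plainCopies≢overlined∷ k t _ eq)
... | _ | k , refl , _ | inj₂ (refl , _) | inj₁ (refl , _) = ⊥-elim (plainCopies≢overlined∷ k t _ (sym eq))

block-unique : ∀ κ t w → Unique (block κ t w)
block-unique free t = ⊗-unique (nonOverlined t) (optionalOverlined t)
  (nonOverlined-unique t) (optionalOverlined-unique t)
  (nonOverlined-weighted t) (λ {i} {i'} {j} {j'} → optional-plain-split t {i} {i'} {j} {j'})
block-unique once   t w = singletonIf-unique w t _
block-unique absent t w = singletonIf-unique w 0 _

obeys-++⁺ : ∀ κ {t t'} y x → All (λ p → size p ≡ t) y → All (λ p → size p < t) x → t' < t →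
  Obeys κ t' x → Obeys κ t' (y ++ x)
obeys-++⁺ free y x ay ax t'<t _ = tt
obeys-++⁺ once {t} {t'} y x ay ax t'<t ((b , t'∈x) , overlined) = (b , ∈-++⁺ʳ y t'∈x) , overlined′
  where
  overlined′ : ∀ b' → (t' , b') ∈ y ++ x → b' ≡ true
  overlined′ b' p with ∈-++-by-size y x ay ax p
  ... | inj₁ (_ , t'≡t) = ⊥-elim (ℕP.<⇒≢ t'<t t'≡t)
  ... | inj₂ (q , _) = overlined b' q
obeys-++⁺ absent y x ay ax t'<t t'∉x (b , p) with ∈-++-by-size y x ay ax p
... | inj₁ (_ , t'≡t) = ⊥-elim (ℕP.<⇒≢ t'<t t'≡t)
... | inj₂ (q , _) = t'∉x (b , q)

obeys-++⁻ : ∀ κ {t t'} y x → All (λ p → size p ≡ t) y → All (λ p → size p < t) x → t' < t →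
  Obeys κ t' (y ++ x) → Obeys κ t' x
obeys-++⁻ free y x ay ax t'<t _ = tt
obeys-++⁻ once y x ay ax t'<t ((b , p) , overlined) with ∈-++-by-size y x ay ax p
... | inj₁ (_ , t'≡t) = ⊥-elim (ℕP.<⇒≢ t'<t t'≡t)
... | inj₂ (q , _) = (b , q) , λ b' r → overlined b' (∈-++⁺ʳ y r)
obeys-++⁻ absent y x ay ax t'<t t'∉ (b , p) = t'∉ (b , ∈-++⁺ʳ y p)

BlockShape⇒obeys : ∀ κ {t} y x → BlockShape κ t y → All (λ p → size p < t) x → Obeys κ t (y ++ x)
BlockShape⇒obeys free y x _ ax = tt
BlockShape⇒obeys once {t} .((t , true) ∷ []) x refl ax = (true , here refl) , overlined
  where
  overlined : ∀ b → (t , b) ∈ (t , true) ∷ x → b ≡ true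
  overlined b (here eq) = cong proj₂ eq
  overlined b (there q) = ⊥-elim (ℕP.<-irrefl refl (lookup ax q))
BlockShape⇒obeys absent .[] x refl ax (b , q) = ℕP.<-irrefl refl (lookup ax q)

enumerate-sound : ∀ κ N w {π} → π ∈ enumerate κ N w → Admissible κ N w π
enumerate-sound κ zero w p with ∈-singletonIf⁻ p
... | w≡0 , refl = ([] , []) , [] , sym w≡0 , λ t 1≤t t≤0 → ⊥-elim (ℕP.<-irrefl refl (ℕP.≤-trans 1≤t t≤0))
enumerate-sound κ (suc N) w p with ∈-⊗⁻ (enumerate κ N) (block (κ (suc N)) (suc N)) w p
... | i , x , y , i≤w , x∈ , y∈ , refl with enumerate-sound κ N i x∈ | block-sound (κ (suc N)) (suc N) (w ∸ i) y∈
...   | (x-pos , x-linked) , x≤N , x-weight , x-obeys | y-size , y-linked , y-weight , shape =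
  (AllP.++⁺ y-pos x-pos , Linked-++⁺ y x y-linked y-size x-linked x<1+N) ,
  AllP.++⁺ (All.map ℕP.≤-reflexive y-size) (All.map ℕP.m≤n⇒m≤1+n x≤N) ,
  trans (weight-++ y x) (trans (cong₂ ℕ._+_ y-weight x-weight) (ℕP.m∸n+n≡m i≤w)) ,
  obeys
  where
  x<1+N : All (λ p → size p < suc N) x
  x<1+N = All.map s≤s x≤N
  y-pos : All (λ p → 1 ≤ size p) y
  y-pos = All.map (λ size≡ → subst (1 ≤_) (sym size≡) (s≤s z≤n)) y-size
  obeys : ∀ t → 1 ≤ t → t ≤ suc N → Obeys (κ t) t (y ++ x)
  obeys t 1≤t t≤1+N with t ℕ.≟ suc N
  ... | yes refl = BlockShape⇒obeys (κ (suc N)) y x shape x<1+N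
  ... | no t≢1+N = obeys-++⁺ (κ t) y x y-size x<1+N t<1+N (x-obeys t 1≤t (ℕP.≤-pred t<1+N))
    where t<1+N = ℕP.≤∧≢⇒< t≤1+N t≢1+N

enumerate-unique : ∀ κ N w → Unique (enumerate κ N w)
enumerate-unique κ zero w = singletonIf-unique w 0 []
enumerate-unique κ (suc N) =
  ⊗-unique (enumerate κ N) B (enumerate-unique κ N) (block-unique (κ (suc N)) (suc N))
    weight≡ split
  where
  B = block (κ (suc N)) (suc N)
  weight≡ : ∀ {i x} → x ∈ enumerate κ N i → weight x ≡ i
  weight≡ {i} x∈ = proj₁ (proj₂ (proj₂ (enumerate-sound κ N i x∈)))
  below : ∀ {i x} → x ∈ enumerate κ N i → All (λ p → size p < suc N) x
  below {i} x∈ = All.map s≤s (proj₁ (proj₂ (enumerate-sound κ N i x∈)))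
  block-size : ∀ {j y} → y ∈ B j → All (λ p → size p ≡ suc N) y
  block-size {j} y∈ = proj₁ (block-sound (κ (suc N)) (suc N) j y∈)
  split : ∀ {i i' j j' x x' y y'} → x ∈ enumerate κ N i → x' ∈ enumerate κ N i' →
    y ∈ B j → y' ∈ B j' → y ++ x ≡ y' ++ x' → y ≡ y'
  split {y = y} {y'} x∈ x'∈ y∈ y'∈ =
    split-injective y y' (block-size y∈) (block-size y'∈) (below x∈) (below x'∈)

-- Within a linked block of equal sizes only the first part can be overlined.
block-tail-plain : ∀ {t} p ys → All (λ q → size q ≡ t) ys → Linked NextPart (p ∷ ys) → size p ≡ t →
  ys ≡ plainCopies (length ys) t
block-tail-plain p [] _ _ _ = refl
block-tail-plain (s , c) ((u , b) ∷ ys) (refl ∷ ays) (inj₁ u<s ∷ l) refl = ⊥-elim (ℕP.<-irrefl refl u<s)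
block-tail-plain (s , c) ((u , b) ∷ ys) (refl ∷ ays) (inj₂ (_ , refl) ∷ l) refl =
  cong ((u , false) ∷_) (block-tail-plain (u , false) ys ays l refl)

block-shape : ∀ {t} y → All (λ p → size p ≡ t) y → Linked NextPart y →
  ∃[ o ] ∃[ j ] ((o ≡ [] ⊎ o ≡ (t , true) ∷ []) × y ≡ o ++ plainCopies j t)
block-shape [] _ _ = [] , 0 , inj₁ refl , refl
block-shape ((u , true) ∷ ys) (refl ∷ ays) l =
  (u , true) ∷ [] , length ys , inj₂ refl , cong ((u , true) ∷_) (block-tail-plain (u , true) ys ays l refl)
block-shape ((u , false) ∷ ys) (refl ∷ ays) l =
  [] , suc (length ys) , inj₁ refl , cong ((u , false) ∷_) (block-tail-plain (u , false) ys ays l refl)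

plainCopies∈nonOverlined : ∀ j t → 1 ≤ t → plainCopies j t ∈ nonOverlined t (weight (plainCopies j t))
plainCopies∈nonOverlined j t 1≤t = ∈-concatUpTo⁺ (suc (weight (plainCopies j t))) _
  (s≤s (subst (j ≤_) (sym (weight-plainCopies j t)) (ℕP.m≤m*n j t)))
  (∈-singletonIf⁺ (j ℕ.* t) (weight (plainCopies j t)) (plainCopies j t) (sym (weight-plainCopies j t)))
  where instance _ = ℕ.>-nonZero 1≤t

∈-optionalOverlined⁺ : ∀ {t} o → (o ≡ [] ⊎ o ≡ (t , true) ∷ []) → o ∈ optionalOverlined t (weight o)
∈-optionalOverlined⁺ .[] (inj₁ refl) = ∈-++⁺ˡ (∈-singletonIf⁺ 0 0 [] refl)
∈-optionalOverlined⁺ {t} .((t , true) ∷ []) (inj₂ refl) =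
  ∈-++⁺ʳ (singletonIf (t ℕ.+ 0) 0 []) (∈-singletonIf⁺ (t ℕ.+ 0) t _ (ℕP.+-identityʳ t))

block-complete : ∀ κ {t} y x → 1 ≤ t → All (λ p → size p ≡ t) y → Linked NextPart y →
  All (λ p → size p < t) x → Obeys κ t (y ++ x) → y ∈ block κ t (weight y)
block-complete free {t} y x 1≤t ay ly ax _ with block-shape y ay ly
... | o , j , o-shape , refl =
  subst (λ w → o ++ plainCopies j t ∈ (nonOverlined t ⊗ optionalOverlined t) w) (sym (weight-++ o (plainCopies j t)))
    (∈-⊗⁺ (nonOverlined t) (optionalOverlined t) (weight o ℕ.+ weight (plainCopies j t))
      (ℕP.m≤n+m _ (weight o)) (plainCopies∈nonOverlined j t 1≤t)
      (subst (λ w → o ∈ optionalOverlined t w) (sym (ℕP.m+n∸n≡m (weight o) (weight (plainCopies j t))))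
             (∈-optionalOverlined⁺ o o-shape)))
block-complete once {t} y x 1≤t ay ly ax ((b , t∈) , overlined) with block-shape y ay ly
... | o , suc j , _ , refl = ⊥-elim (false≢true (overlined false (∈-++⁺ˡ (∈-++⁺ʳ o (here refl)))))
  where
  false≢true : false ≡ true → ⊥
  false≢true ()
... | .[] , zero , inj₁ refl , refl = ⊥-elim (ℕP.<-irrefl refl (lookup ax t∈))
... | .((t , true) ∷ []) , zero , inj₂ refl , refl = ∈-singletonIf⁺ (t ℕ.+ 0) t _ (ℕP.+-identityʳ t)
block-complete absent [] x 1≤t ay ly ax _ = ∈-singletonIf⁺ 0 0 [] refl
block-complete absent ((u , b) ∷ y) x 1≤t (refl ∷ ay) ly ax u∉ = ⊥-elim (u∉ (b , here refl))

enumerate-complete : ∀ κ N w π → Admissible κ N w π → π ∈ enumerate κ N w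
enumerate-complete κ zero w [] (_ , _ , 0≡w , _) = ∈-singletonIf⁺ w 0 [] (sym 0≡w)
enumerate-complete κ zero w (p ∷ π) ((pos ∷ _ , _) , p≤0 ∷ _ , _) = ⊥-elim (ℕP.<-irrefl refl (ℕP.≤-trans pos p≤0))
enumerate-complete κ (suc N) w π ((pos , linked) , π≤1+N , weight≡ , obeys) with split-at-size (suc N) π π≤1+N linked
... | y , x , refl , ay , x<1+N =
  subst (λ v → y ++ x ∈ enumerate κ (suc N) v) (trans (sym (weight-++ y x)) weight≡)
    (∈-⊗⁺ (enumerate κ N) (block (κ (suc N)) (suc N)) (weight y ℕ.+ weight x) (ℕP.m≤n+m (weight x) (weight y)) x∈
      (subst (λ v → y ∈ block (κ (suc N)) (suc N) v) (sym (ℕP.m+n∸n≡m (weight y) (weight x)))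
        (block-complete (κ (suc N)) y x (s≤s z≤n) ay (Linked-++⁻ˡ y linked) x<1+N (obeys (suc N) (s≤s z≤n) ℕP.≤-refl))))
  where
  x∈ : x ∈ enumerate κ N (weight x)
  x∈ = enumerate-complete κ N (weight x) x
    ( (AllP.++⁻ʳ y pos , Linked-++⁻ʳ y linked) , All.map ℕP.≤-pred x<1+N , refl
    , λ t 1≤t t≤N → obeys-++⁻ (κ t) y x ay x<1+N (s≤s t≤N) (obeys t 1≤t (ℕP.m≤n⇒m≤1+n t≤N)))

-- Overpartitions in Omes with a given mes

parts≤weight : ∀ π → All (λ p → size p ≤ weight π) π
parts≤weight [] = []
parts≤weight (p ∷ π) = ℕP.m≤m+n (size p) (weight π) ∷
  All.map (λ q≤ → ℕP.≤-trans q≤ (ℕP.m≤n+m (weight π) (size p))) (parts≤weight π)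

IsMes-unique : ∀ {A a π x x'} → IsMes A a π x → IsMes A a π x' → x ≡ x'
IsMes-unique {x = x} {x'} (1≤x , x≡a , x∉ , below-x) (1≤x' , x'≡a , x'∉ , below-x') with ℕP.<-cmp x x'
... | tri< x<x' _ _ = ⊥-elim (x∉ (below-x' x 1≤x x<x' x≡a))
... | tri≈ _ x≡x' _ = x≡x'
... | tri> _ _ x'<x = ⊥-elim (x'∉ (below-x x' 1≤x' x'<x x'≡a))

module Omes (A a : ℕ) (1≤a : 1 ≤ a) (a≤A : a ≤ A) where

  open Progression A a 1≤a (ℕP.≤-trans 1≤a a≤A) public

  ap≡a : ∀ j → ap j ≡ a [mod A ]
  ap≡a j = divides j (trans (ℕP.m≤n⇒∣n-m∣≡n∸m (ℕP.m≤m+n a (j ℕ.* A))) (ℕP.m+n∸m≡n a (j ℕ.* A)))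

  -- Here a ≤ A is used: a positive y ≡ a (mod A) cannot lie below a.
  ≡a⇒ap : ∀ y → 1 ≤ y → y ≡ a [mod A ] → ∃[ j ] (y ≡ ap j)
  ≡a⇒ap y 1≤y (divides q ∣y-a∣≡qA) with a ℕ.≤? y
  ... | yes a≤y = q , trans (sym (ℕP.m+[n∸m]≡n a≤y))
                        (cong (a ℕ.+_) (trans (sym (ℕP.m≤n⇒∣n-m∣≡n∸m a≤y)) ∣y-a∣≡qA))
  ... | no a≰y = ⊥-elim (ℕP.<-irrefl refl (ℕP.<-≤-trans a∸y<A (∣⇒≤ {{ℕ.>-nonZero 0<a∸y}} (divides q a∸y≡qA))))
    where
    y<a = ℕP.≰⇒> a≰y
    a∸y≡qA : a ∸ y ≡ q ℕ.* A
    a∸y≡qA = trans (sym (ℕP.m≤n⇒∣m-n∣≡n∸m (ℕP.<⇒≤ y<a))) ∣y-a∣≡qA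
    0<a∸y : a ∸ y > 0
    0<a∸y = ℕP.m<n⇒0<n∸m y<a
    a∸y<A : a ∸ y < A
    a∸y<A = ℕP.<-≤-trans (ℕP.∸-monoʳ-< {a} {y} {0} 1≤y (ℕP.<⇒≤ y<a)) a≤A

  OmesWithMes : ℕ → ℕ → List Part → Set
  OmesWithMes m n π = IsOverpartition π × InOmes A a π × IsMes A a π m × weight π ≡ n

  OmesWithMes⇒Admissible : ∀ k N n π → n ≤ N → OmesWithMes (ap k) n π → Admissible (kindOf k) N n π
  OmesWithMes⇒Admissible k N n π n≤N (overpartition , omes , mes@(_ , _ , ap-k∉ , below) , weight≡n) =
    overpartition , All.map (λ p≤ → ℕP.≤-trans p≤ (ℕP.≤-trans (ℕP.≤-reflexive weight≡n) n≤N)) (parts≤weight π) ,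
    weight≡n , obeys
    where
    obeys : ∀ t → 1 ≤ t → t ≤ N → Obeys (kindOf k t) t π
    obeys t 1≤t t≤N with kindOf-cases k t
    ... | inj₁ (kind≡ , refl) = subst (λ κ → Obeys κ t π) (sym kind≡) ap-k∉
    ... | inj₂ (inj₁ (kind≡ , j , j<k , refl)) = subst (λ κ → Obeys κ t π) (sym kind≡)
          (below t 1≤t (ap-monoʳ-< j<k) (ap≡a j) , λ b p → omes (ap k) mes t b p (ap≡a j) (ap-monoʳ-< j<k))
    ... | inj₂ (inj₂ kind≡) = subst (λ κ → Obeys κ t π) (sym kind≡) tt

  Admissible⇒OmesWithMes : ∀ k N n π → ap k ≤ N → Admissible (kindOf k) N n π → OmesWithMes (ap k) n π
  Admissible⇒OmesWithMes k N n π ap-k≤N (overpartition@(positive , _) , _ , weight≡n , obeys) =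
    overpartition , omes , mes , weight≡n
    where
    once-below : ∀ j → j < k → Obeys once (ap j) π
    once-below j j<k = subst (λ κ → Obeys κ (ap j) π) (kindOf-ap-< k j j<k)
      (obeys (ap j) (1≤ap j) (ℕP.≤-trans (ℕP.<⇒≤ (ap-monoʳ-< j<k)) ap-k≤N))
    below : ∀ y → 1 ≤ y → y < ap k → y ≡ a [mod A ] → HasSize π y
    below y 1≤y y<ap-k y≡a with ≡a⇒ap y 1≤y y≡a
    ... | j , refl = proj₁ (once-below j (ap-cancel-< y<ap-k))
    mes : IsMes A a π (ap k)
    mes = 1≤ap k , ap≡a k , subst (λ κ → Obeys κ (ap k) π) (kindOf-ap k) (obeys (ap k) (1≤ap k) ap-k≤N) , below
    omes : InOmes A a π
    omes x mes-x t b p t≡a t<x with IsMes-unique mes-x mes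
    ... | refl with ≡a⇒ap t (lookup positive p) t≡a
    ...   | j , refl = proj₂ (once-below j (ap-cancel-< t<x)) b p

  rhsCoeff-ap : ∀ k n → rhsCoeff A a (ap k) n ≡ (minusQQ∞ ⊛ invQQ∞ ⊛ bracket A a k) n
  rhsCoeff-ap k n = trans
    (sumTo-single (suc (ap k)) k _ (s≤s (ℕP.≤-trans (ℕP.m≤m*n k A) (ℕP.m≤n+m (k ℕ.* A) a))) other-k)
    (ifEq-≡ _ (ℕP.+-comm (k ℕ.* A) a))
    where
    other-k : ∀ k' → k' < suc (ap k) → ¬ k' ≡ k → ifEq (k' ℕ.* A ℕ.+ a) (ap k) _ ≡ + 0
    other-k k' _ k'≢k = ifEq-≢ _ λ eq → k'≢k (ap-injective (trans (ℕP.+-comm a (k' ℕ.* A)) eq))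

  omes-at-ap : ∀ k n → ∃[ L ] (Unique L × (∀ π → π ∈ L ⇔ OmesWithMes (ap k) n π) ×
                                + length L ≡ rhsCoeff A a (ap k) n)
  omes-at-ap k n =
    enumerate (kindOf k) N n , enumerate-unique (kindOf k) N n ,
    (λ π → mk⇔ (λ π∈ → Admissible⇒OmesWithMes k N n π ap-k≤N (enumerate-sound (kindOf k) N n π∈))
               (λ omes → enumerate-complete (kindOf k) N n π (OmesWithMes⇒Admissible k N n π n≤N omes))) ,
    (begin
      count (enumerate (kindOf k) N) n                       ≡⟨ count-enumerate (kindOf k) N n ⟩
      prodTo N (λ i → kindGF (kindOf k (suc i)) (suc i)) n    ≡⟨ sym (rhsTerm≡prodTo-kindGF N k n n≤N ap-k≤N) ⟩
      (minusQQ∞ ⊛ invQQ∞ ⊛ bracket A a k) n                  ≡⟨ sym (rhsCoeff-ap k n) ⟩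
      rhsCoeff A a (ap k) n                                  ∎)
    where
    open ≡-Reasoning
    N = n ℕ.+ ap k
    n≤N = ℕP.m≤m+n n (ap k)
    ap-k≤N = ℕP.m≤n+m (ap k) n

  omes-off-ap : ∀ m n → (∀ k → ¬ m ≡ ap k) → ∃[ L ] (Unique L × (∀ π → π ∈ L ⇔ OmesWithMes m n π) ×
                                                     + length L ≡ rhsCoeff A a m n)
  omes-off-ap m n m∉ap =
    [] , [] , (λ π → mk⇔ (λ ()) (λ (_ , _ , (1≤m , m≡a , _) , _) → ⊥-elim (no-mes 1≤m m≡a))) ,
    sym (sumTo-zero (suc m) λ k _ → ifEq-≢ _ λ eq → m∉ap k (trans (sym eq) (ℕP.+-comm (k ℕ.* A) a)))
    where
    no-mes : 1 ≤ m → m ≡ a [mod A ] → ⊥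
    no-mes 1≤m m≡a with ≡a⇒ap m 1≤m m≡a
    ... | k , m≡ap-k = m∉ap k m≡ap-k

  ap? : ∀ m → (∃[ k ] m ≡ ap k) ⊎ (∀ k → ¬ m ≡ ap k)
  ap? m with a ℕ.≤? m | A ∣? (m ∸ a)
  ... | yes a≤m | yes (divides k m∸a≡kA) = inj₁ (k , trans (sym (ℕP.m+[n∸m]≡n a≤m)) (cong (a ℕ.+_) m∸a≡kA))
  ... | no a≰m | _ = inj₂ λ k m≡ap-k → a≰m (subst (a ≤_) (sym m≡ap-k) (ℕP.m≤m+n a (k ℕ.* A)))
  ... | yes _ | no A∤m∸a = inj₂ λ k m≡ap-k →
    A∤m∸a (divides k (trans (cong (_∸ a) m≡ap-k) (ℕP.m+n∸m≡n a (k ℕ.* A))))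

theorem2p4 : (A a : ℕ) → 1 ≤ a → a ≤ A → (m n : ℕ) →
    ∃[ L ] (Unique L ×
      (∀ (π : List Part) → π ∈ L ⇔
         (IsOverpartition π × InOmes A a π × IsMes A a π m × weight π ≡ n)) ×
      + length L ≡ rhsCoeff A a m n)
theorem2p4 A a 1≤a a≤A m n with Omes.ap? A a 1≤a a≤A m
... | inj₁ (k , refl) = Omes.omes-at-ap A a 1≤a a≤A k n
... | inj₂ m∉ap = Omes.omes-off-ap A a 1≤a a≤A m n m∉ap
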